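{- Let $n\ge 0$ and $n'=\lfloor n/2\rfloor$. For every $f\in\Lambda^*_n$ there exist unique $h_i\in\mathcal{H}_{n-2i}$ ($i=0,1,\ldots,n'$) such that $$f=h_0+Q_2h_1+Q_2^2h_2+\cdots+Q_2^{n'}h_{n'}.$$
   Context: Partitions are non-increasing sequences $\lambda=(\lambda_1,\lambda_2,\ldots)$ of non-negative integers, eventually $0$; $|\lambda|=\sum\lambda_i$. Let $\mathcal{S}$ be the set of non-increasing, eventually constant integer sequences. For $\lambda\in\mathcal{S}$ with eventual value $n$, define $Q_k(\lambda)$ ($k\ge0$) by $\sum_{k\ge0}Q_k(\lambda)z^{k-1}=e^{nz}\big(\frac{1}{e^{z/2}-e^{ -z/2}}+\sum_{i\ge1}(e^{z(\lambda_i-n-i+1/2)}-e^{z(-i+1/2)})\big)$ (Laurent expansion at $z=0$). Then $Q_0=1$, $Q_1(\lambda)=n$, and $Q_2(\lambda)=|\lambda|-\tfrac1{24}$ on partitions. Let $\Lambda^*=\mathbb{Q}[Q_2,Q_3,\ldots]$ (functions on partitions) and $\mathcal{R}=\mathbb{Q}[Q_1,Q_2,\ldots]$ (functions on $\mathcal{S}$; the $Q_i$, $i\ge1$, are algebraically independent), graded by giving $Q_i$ weight $i$; subscript $n$ denotes the weight-$n$ part. With $Q_0:=1$, define on $\mathcal{R}$ the operators $\boldsymbol{\partial}=\sum_{m\ge0}Q_m\frac{\partial}{\partial Q_{m+1}}$, $\mathscr{D}=\sum_{k,\ell\ge0}\binom{k+\ell}{k}Q_{k+\ell}\frac{\partial^2}{\partial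 Q_{k+1}\partial Q_{\ell+1}}$, $\Delta=\tfrac12(\mathscr{D}-\boldsymbol{\partial}^2)$. Let $\mathcal{H}=\{f\in\Lambda^*:\Delta f\in Q_1\mathcal{R}\}$ and $\mathcal{H}_m=\mathcal{H}\cap\Lambda^*_m$ (with $\mathcal{H}_m=0$ for $m<0$). -}

module Defs where

open import Data.Bool using (Bool; true; false; _∧_; if_then_else_)
open import Data.Nat as ℕ using (ℕ; zero; suc; _≡ᵇ_)
open import Data.Nat.Combinatorics using (_C_)
open import Data.Integer using (+_)
open import Data.Rational as ℚ using (ℚ; 0ℚ; 1ℚ; ½)
open import Data.List using (List; []; _∷_; map; concatMap; _++_; length; foldr; upTo)
open import Data.Fin using (Fin; zero; suc; toℕ)
open import Data.Product using (_×_; _,_; Σ; ∃)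
open import Relation.Binary.PropositionalEquality using (_≡_; _≢_)

-- A monomial in Q₁, Q₂, Q₃, … is its exponent vector: position j (from 0)
-- holds the exponent of Q_{j+1}.  Trailing zeros are irrelevant.
Mono : Set
Mono = List ℕ

-- A polynomial in ℛ = ℚ[Q₁,Q₂,…] is a finite formal sum of terms c·m.
-- Polynomials are compared via their coefficient functions (see _≈_).
Poly : Set
Poly = List (ℚ × Mono)

allZero : Mono → Bool
allZero [] = true
allZero (e ∷ es) = (e ≡ᵇ 0) ∧ allZero es

monoEq : Mono → Mono → Bool
monoEq [] m = allZero m
monoEq (a ∷ as) [] = allZero (a ∷ as)
monoEq (a ∷ as) (b ∷ bs) = (a ≡ᵇ b) ∧ monoEq as bs

coeff : Poly → Mono → ℚ
coeff [] m = 0ℚ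
coeff ((c , m′) ∷ p) m = if monoEq m′ m then c ℚ.+ coeff p m else coeff p m

infix 4 _≈_
_≈_ : Poly → Poly → Set
p ≈ q = ∀ m → coeff p m ≡ coeff q m

ℕtoℚ : ℕ → ℚ
ℕtoℚ k = (+ k) ℚ./ 1

addMono : Mono → Mono → Mono
addMono [] m = m
addMono (a ∷ as) [] = a ∷ as
addMono (a ∷ as) (b ∷ bs) = (a ℕ.+ b) ∷ addMono as bs

const : ℚ → Poly
const c = (c , []) ∷ []

zeroP : Poly
zeroP = []

infixl 6 _+ᴾ_
_+ᴾ_ : Poly → Poly → Poly
p +ᴾ q = p ++ q

scale : ℚ → Poly → Poly
scale c p = map (λ { (d , m) → (c ℚ.* d , m) }) p

-ᴾ_ : Poly → Poly
-ᴾ p = scale (ℚ.- 1ℚ) p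

infixl 7 _*ᴾ_
_*ᴾ_ : Poly → Poly → Poly
p *ᴾ q = concatMap (λ { (c , m) → map (λ { (d , m′) → (c ℚ.* d , addMono m m′) }) q }) p

_^ᴾ_ : Poly → ℕ → Poly
p ^ᴾ zero = const 1ℚ
p ^ᴾ suc k = p *ᴾ (p ^ᴾ k)

unitMono : ℕ → Mono
unitMono zero = 1 ∷ []
unitMono (suc j) = 0 ∷ unitMono j

-- Q k, with the convention Q 0 = 1
Q : ℕ → Poly
Q zero = const 1ℚ
Q (suc j) = (1ℚ , unitMono j) ∷ []

-- ∂/∂Q_{j+1} on a monomial: (old exponent, monomial with exponent lowered)
dMono : ℕ → Mono → ℕ × Mono
dMono _ [] = (0 , [])
dMono zero (e ∷ es) = (e , ℕ.pred e ∷ es)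
dMono (suc j) (e ∷ es) with dMono j es
... | (k , es′) = (k , e ∷ es′)

-- partial derivative ∂/∂Q_{j+1}
deriv : ℕ → Poly → Poly
deriv j p = map (λ { (c , m) → let r = dMono j m in
                    (c ℚ.* ℕtoℚ (Data.Product.proj₁ r) , Data.Product.proj₂ r) }) p

-- number of variables that can occur in p (all derivatives ∂/∂Q_{j+1}, j ≥ this, vanish)
maxLen : Poly → ℕ
maxLen = foldr (λ { (c , m) r → length m ℕ.⊔ r }) 0

sumP : List Poly → Poly
sumP = foldr _+ᴾ_ zeroP

-- 𝛛 = Σ_{m≥0} Q_m ∂/∂Q_{m+1}   (finite sum: higher terms vanish on p)
bd : Poly → Poly
bd p = sumP (map (λ m → Q m *ᴾ deriv m p) (upTo (maxLen p)))

𝒟 : Poly → Poly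
𝒟 p = sumP (map (λ k → sumP (map (λ l →
        scale (ℕtoℚ ((k ℕ.+ l) C k)) (Q (k ℕ.+ l) *ᴾ deriv k (deriv l p)))
        (upTo (maxLen p)))) (upTo (maxLen p)))

Δ : Poly → Poly
Δ p = scale ½ (𝒟 p +ᴾ (-ᴾ bd (bd p)))

weightFrom : ℕ → Mono → ℕ
weightFrom i [] = 0
weightFrom i (e ∷ es) = i ℕ.* e ℕ.+ weightFrom (suc i) es

weight : Mono → ℕ
weight = weightFrom 1

-- f ∈ Λ* = ℚ[Q₂,Q₃,…]: no monomial containing Q₁ occurs
InΛ : Poly → Set
InΛ p = ∀ e m → coeff p (suc e ∷ m) ≡ 0ℚ

Homog : ℕ → Poly → Set
Homog n p = ∀ m → weight m ≢ n → coeff p m ≡ 0ℚ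

InΛw : ℕ → Poly → Set
InΛw n p = InΛ p × Homog n p

InH : ℕ → Poly → Set
InH n p = InΛw n p × Σ Poly (λ g → Δ p ≈ Q 1 *ᴾ g)

decomp : (k : ℕ) → (Fin k → Poly) → Poly
decomp zero h = zeroP
decomp (suc k) h = h zero +ᴾ Q 2 *ᴾ decomp k (λ i → h (suc i))

{-# OPTIONS --safe #-}
-- Write Δ̄ for Δ taken modulo Q₁. On Λ* it lowers the weight by 2 and vanishes in weights 0 and 1, and
-- f ∈ Λ*_n lies in ℋ_n exactly when Δ̄ f = 0. The Leibniz rule and Euler's identity for the weight give
-- the commutation relation Δ̄ (Q₂ x) = Q₂ (Δ̄ x) + (n − ½) x for x ∈ Λ*_n. Consequently the operators
-- Θ_{m,k} = Q₂ Δ̄ + (k + 1)(m + k − ½) satisfy Δ̄ ∘ Θ_{m+2,k} = Θ_{m,k+1} ∘ Δ̄, and induction on the weight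
-- shows that every Θ_{m,k} is a bijection of Λ*_m. For f ∈ Λ*_{n+2}, if Θ_{n,0} x = Δ̄ f then f − Q₂ x is
-- harmonic, and injectivity of Θ_{n,0} = Q₂ Δ̄ + (n − ½) makes Λ*_{n+2} = ℋ_{n+2} ⊕ Q₂ Λ*_n a direct sum;
-- iterating this splitting gives the decomposition.
module Submission where

open import Defs
open import Algebra.Bundles using (CommutativeMonoid)
import Algebra.Properties.CommutativeSemigroup as CommSemigroupProps
open import Data.Bool using (true; false; T; if_then_else_)
open import Data.Bool.Properties using (T-∧)
open import Data.Empty using (⊥-elim)
open import Data.Fin using (Fin; zero; suc; toℕ)
import Data.Integer as ℤ
import Data.Integer.Properties as ℤ
open import Data.List using ([]; _∷_; map; length; upTo; applyUpTo)
open import Data.List.Properties using (map-cong)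
open import Data.Nat as ℕ using (ℕ; zero; suc; pred; _≡ᵇ_; _≤_; _<_; _⊔_; _∸_; _/_; ⌊_/2⌋; z≤n; s≤s)
import Data.Nat.Properties as ℕ
open import Data.Nat.Combinatorics using (_C_; nCk≡nC[n∸k]; nC1≡n)
open import Data.Nat.DivMod using (m/n≡1+[m∸n]/n)
open import Data.Product using (Σ; _×_; _,_; proj₁; proj₂)
open import Data.Rational as ℚ using (ℚ; 0ℚ; 1ℚ; ½; _+_; _*_; -_; _-_; toℚᵘ)
open import Data.Rational.Properties
open import Data.Rational.Solver using (module +-*-Solver)
import Data.Rational.Unnormalised as ℚᵘ
import Data.Rational.Unnormalised.Properties as ℚᵘ
open import Data.Unit using (tt)
open import Function using (_∘_; id; Equivalence)
open import Level using (0ℓ)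
open import Relation.Binary using (Setoid)
open import Relation.Binary.PropositionalEquality
import Relation.Binary.Reasoning.Setoid as SetoidReasoning
open import Relation.Nullary using (¬_; yes; no)
open import Relation.Nullary.Reflects using (Reflects; ofʸ; ofⁿ; fromEquivalence; det)

open +-*-Solver using (solve; _:+_; _:-_; _:*_; _:=_; con)

-- Monomials

exponent : Mono → ℕ → ℕ
exponent [] j = 0
exponent (e ∷ es) zero = e
exponent (e ∷ es) (suc j) = exponent es j

infix 4 _∼_
record _∼_ (a b : Mono) : Set where
  constructor mk∼
  field exponent-≡ : ∀ j → exponent a j ≡ exponent b j
open _∼_

∼-sym : ∀ {a b} → a ∼ b → b ∼ a
∼-sym a∼b = mk∼ λ j → sym (exponent-≡ a∼b j)

∼-trans : ∀ {a b c} → a ∼ b → b ∼ c → a ∼ c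
∼-trans a∼b b∼c = mk∼ λ j → trans (exponent-≡ a∼b j) (exponent-≡ b∼c j)

∼-tail : ∀ {x y a b} → (x ∷ a) ∼ (y ∷ b) → a ∼ b
∼-tail x∷a∼y∷b = mk∼ λ j → exponent-≡ x∷a∼y∷b (suc j)

allZero-sound : ∀ m → T (allZero m) → ∀ j → exponent m j ≡ 0
allZero-sound [] _ j = refl
allZero-sound (e ∷ es) t zero = ℕ.≡ᵇ⇒≡ e 0 (proj₁ (Equivalence.to T-∧ t))
allZero-sound (e ∷ es) t (suc j) = allZero-sound es (proj₂ (Equivalence.to (T-∧ {e ≡ᵇ 0}) t)) j

allZero-complete : ∀ m → (∀ j → exponent m j ≡ 0) → T (allZero m)
allZero-complete [] _ = tt
allZero-complete (e ∷ es) z =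
  Equivalence.from T-∧ (ℕ.≡⇒≡ᵇ e 0 (z zero) , allZero-complete es (z ∘ suc))

monoEq-sound : ∀ a b → T (monoEq a b) → a ∼ b
monoEq-sound [] b t = mk∼ λ j → sym (allZero-sound b t j)
monoEq-sound (x ∷ a) [] t = mk∼ (allZero-sound (x ∷ a) t)
monoEq-sound (x ∷ a) (y ∷ b) t = mk∼ λ where
    zero → ℕ.≡ᵇ⇒≡ x y (proj₁ x≡y×a∼b)
    (suc j) → exponent-≡ (monoEq-sound a b (proj₂ x≡y×a∼b)) j
  where x≡y×a∼b = Equivalence.to (T-∧ {x ≡ᵇ y}) t

monoEq-complete : ∀ a b → a ∼ b → T (monoEq a b)
monoEq-complete [] b a∼b = allZero-complete b λ j → sym (exponent-≡ a∼b j)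
monoEq-complete (x ∷ a) [] a∼b = allZero-complete (x ∷ a) (exponent-≡ a∼b)
monoEq-complete (x ∷ a) (y ∷ b) a∼b =
  Equivalence.from T-∧ (ℕ.≡⇒≡ᵇ x y (exponent-≡ a∼b zero) , monoEq-complete a b (∼-tail a∼b))

monoEq-reflects : ∀ a b → Reflects (a ∼ b) (monoEq a b)
monoEq-reflects a b = fromEquivalence (monoEq-sound a b) (monoEq-complete a b)

monoEq-≡ : ∀ {a b c d} → (a ∼ b → c ∼ d) → (c ∼ d → a ∼ b) → monoEq a b ≡ monoEq c d
monoEq-≡ {a} {b} {c} {d} to from =
  det (monoEq-reflects a b) (fromEquivalence (from ∘ monoEq-sound c d) (monoEq-complete c d ∘ to))

monoEq-false : ∀ {a b} → ¬ a ∼ b → monoEq a b ≡ false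
monoEq-false {a} {b} a≁b = det (monoEq-reflects a b) (ofⁿ a≁b)

-- Division by Q_{j+1}; it leaves m unchanged when Q_{j+1} does not occur in m.
lower : ℕ → Mono → Mono
lower j m = proj₂ (dMono j m)

raise : ℕ → Mono → Mono
raise j m = addMono (unitMono j) m

exponent-dMono : ∀ j m → proj₁ (dMono j m) ≡ exponent m j
exponent-dMono j [] = refl
exponent-dMono zero (e ∷ es) = refl
exponent-dMono (suc j) (e ∷ es) = exponent-dMono j es

exponent-lower : ∀ j m → exponent (lower j m) j ≡ pred (exponent m j)
exponent-lower j [] = refl
exponent-lower zero (e ∷ es) = refl
exponent-lower (suc j) (e ∷ es) = exponent-lower j es

exponent-lower-other : ∀ j m {k} → j ≢ k → exponent (lower j m) k ≡ exponent m k
exponent-lower-other j [] j≢k = refl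
exponent-lower-other zero (e ∷ es) {zero} j≢k = ⊥-elim (j≢k refl)
exponent-lower-other zero (e ∷ es) {suc k} j≢k = refl
exponent-lower-other (suc j) (e ∷ es) {zero} j≢k = refl
exponent-lower-other (suc j) (e ∷ es) {suc k} j≢k = exponent-lower-other j es (j≢k ∘ cong suc)

exponent-addMono : ∀ a b k → exponent (addMono a b) k ≡ exponent a k ℕ.+ exponent b k
exponent-addMono [] b k = refl
exponent-addMono (x ∷ a) [] k = sym (ℕ.+-identityʳ _)
exponent-addMono (x ∷ a) (y ∷ b) zero = refl
exponent-addMono (x ∷ a) (y ∷ b) (suc k) = exponent-addMono a b k

exponent-unitMono : ∀ j → exponent (unitMono j) j ≡ 1
exponent-unitMono zero = refl
exponent-unitMono (suc j) = exponent-unitMono j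

exponent-unitMono-other : ∀ j {k} → j ≢ k → exponent (unitMono j) k ≡ 0
exponent-unitMono-other zero {zero} j≢k = ⊥-elim (j≢k refl)
exponent-unitMono-other zero {suc k} j≢k = refl
exponent-unitMono-other (suc j) {zero} j≢k = refl
exponent-unitMono-other (suc j) {suc k} j≢k = exponent-unitMono-other j (j≢k ∘ cong suc)

exponent-raise : ∀ j m → exponent (raise j m) j ≡ suc (exponent m j)
exponent-raise j m = trans (exponent-addMono (unitMono j) m j) (cong (ℕ._+ exponent m j) (exponent-unitMono j))

exponent-raise-other : ∀ j m {k} → j ≢ k → exponent (raise j m) k ≡ exponent m k
exponent-raise-other j m {k} j≢k =
  trans (exponent-addMono (unitMono j) m k) (cong (ℕ._+ exponent m k) (exponent-unitMono-other j j≢k))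

lower-raise : ∀ j m → lower j (raise j m) ∼ m
lower-raise j m = mk∼ pointwise
  where
  pointwise : ∀ k → exponent (lower j (raise j m)) k ≡ exponent m k
  pointwise k with j ℕ.≟ k
  ... | yes refl = trans (exponent-lower j (raise j m)) (cong pred (exponent-raise j m))
  ... | no j≢k = trans (exponent-lower-other j (raise j m) j≢k) (exponent-raise-other j m j≢k)

raise-lower : ∀ j m → 0 < exponent m j → raise j (lower j m) ∼ m
raise-lower j m pos = mk∼ pointwise
  where
  pointwise : ∀ k → exponent (raise j (lower j m)) k ≡ exponent m k
  pointwise k with j ℕ.≟ k
  ... | yes refl = trans (exponent-raise j (lower j m))
                         (trans (cong suc (exponent-lower j m)) (ℕ.suc-pred (exponent m j) {{ℕ.>-nonZero pos}}))
  ... | no j≢k = trans (exponent-raise-other j (lower j m) j≢k) (exponent-lower-other j m j≢k)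

lower-raise-comm : ∀ i j m → i ≢ j → lower i (raise j m) ∼ raise j (lower i m)
lower-raise-comm i j m i≢j = mk∼ pointwise
  where
  pointwise : ∀ k → exponent (lower i (raise j m)) k ≡ exponent (raise j (lower i m)) k
  pointwise k with i ℕ.≟ k | j ℕ.≟ k
  ... | yes refl | yes refl = ⊥-elim (i≢j refl)
  ... | yes refl | no j≢k = trans (exponent-lower i (raise j m))
    (trans (cong pred (exponent-raise-other j m j≢k))
    (trans (sym (exponent-lower i m)) (sym (exponent-raise-other j (lower i m) j≢k))))
  ... | no i≢k | yes refl = trans (exponent-lower-other i (raise j m) i≢k)
    (trans (exponent-raise j m)
    (trans (cong suc (sym (exponent-lower-other i m i≢k))) (sym (exponent-raise j (lower i m)))))
  ... | no i≢k | no j≢k = trans (exponent-lower-other i (raise j m) i≢k)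
    (trans (exponent-raise-other j m j≢k)
    (trans (sym (exponent-lower-other i m i≢k)) (sym (exponent-raise-other j (lower i m) j≢k))))

lower-lower-comm : ∀ i j m → lower i (lower j m) ∼ lower j (lower i m)
lower-lower-comm i j m = mk∼ pointwise
  where
  pointwise : ∀ k → exponent (lower i (lower j m)) k ≡ exponent (lower j (lower i m)) k
  pointwise k with i ℕ.≟ k | j ℕ.≟ k
  ... | yes refl | yes refl = refl
  ... | yes refl | no j≢k = trans (exponent-lower i (lower j m))
    (trans (cong pred (exponent-lower-other j m j≢k))
    (trans (sym (exponent-lower i m)) (sym (exponent-lower-other j (lower i m) j≢k))))
  ... | no i≢k | yes refl = trans (exponent-lower-other i (lower j m) i≢k)
    (trans (exponent-lower j m)
    (trans (cong pred (sym (exponent-lower-other i m i≢k))) (sym (exponent-lower j (lower i m)))))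
  ... | no i≢k | no j≢k = trans (exponent-lower-other i (lower j m) i≢k)
    (trans (exponent-lower-other j m j≢k)
    (trans (sym (exponent-lower-other i m i≢k)) (sym (exponent-lower-other j (lower i m) j≢k))))

lower-cong : ∀ j {a b} → a ∼ b → lower j a ∼ lower j b
lower-cong j {a} {b} a∼b = mk∼ pointwise
  where
  pointwise : ∀ k → exponent (lower j a) k ≡ exponent (lower j b) k
  pointwise k with j ℕ.≟ k
  ... | yes refl = trans (exponent-lower j a) (trans (cong pred (exponent-≡ a∼b j)) (sym (exponent-lower j b)))
  ... | no j≢k = trans (exponent-lower-other j a j≢k) (trans (exponent-≡ a∼b k) (sym (exponent-lower-other j b j≢k)))

raise-cong : ∀ j {a b} → a ∼ b → raise j a ∼ raise j b
raise-cong j {a} {b} a∼b = mk∼ λ k → trans (exponent-addMono (unitMono j) a k)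
  (trans (cong (exponent (unitMono j) k ℕ.+_) (exponent-≡ a∼b k)) (sym (exponent-addMono (unitMono j) b k)))

weightFrom-zero : ∀ i m → (∀ k → exponent m k ≡ 0) → weightFrom i m ≡ 0
weightFrom-zero i [] _ = refl
weightFrom-zero i (e ∷ es) z rewrite z zero | ℕ.*-zeroʳ i = weightFrom-zero (suc i) es (z ∘ suc)

weightFrom-cong : ∀ i {a b} → a ∼ b → weightFrom i a ≡ weightFrom i b
weightFrom-cong i {[]} {b} a∼b = sym (weightFrom-zero i b λ k → sym (exponent-≡ a∼b k))
weightFrom-cong i {x ∷ a} {[]} a∼b = weightFrom-zero i (x ∷ a) (exponent-≡ a∼b)
weightFrom-cong i {x ∷ a} {y ∷ b} a∼b =
  cong₂ ℕ._+_ (cong (i ℕ.*_) (exponent-≡ a∼b zero)) (weightFrom-cong (suc i) (∼-tail a∼b))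

weightFrom-addMono : ∀ i a b → weightFrom i (addMono a b) ≡ weightFrom i a ℕ.+ weightFrom i b
weightFrom-addMono i [] b = refl
weightFrom-addMono i (x ∷ a) [] = sym (ℕ.+-identityʳ _)
weightFrom-addMono i (x ∷ a) (y ∷ b)
  rewrite weightFrom-addMono (suc i) a b | ℕ.*-distribˡ-+ i x y =
  CommSemigroupProps.interchange ℕ.+-commutativeSemigroup (i ℕ.* x) (i ℕ.* y) (weightFrom (suc i) a) (weightFrom (suc i) b)

weightFrom-unitMono : ∀ i j → weightFrom i (unitMono j) ≡ i ℕ.+ j
weightFrom-unitMono i zero = trans (ℕ.+-identityʳ (i ℕ.* 1)) (trans (ℕ.*-identityʳ i) (sym (ℕ.+-identityʳ i)))
weightFrom-unitMono i (suc j) rewrite ℕ.*-zeroʳ i | ℕ.+-suc i j = weightFrom-unitMono (suc i) j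

weight-raise : ∀ j m → weight (raise j m) ≡ suc j ℕ.+ weight m
weight-raise j m = trans (weightFrom-addMono 1 (unitMono j) m) (cong (ℕ._+ weight m) (weightFrom-unitMono 1 j))

weight-lower : ∀ j m → 0 < exponent m j → suc j ℕ.+ weight (lower j m) ≡ weight m
weight-lower j m pos = trans (sym (weight-raise j (lower j m))) (weightFrom-cong 1 (raise-lower j m pos))

toℚᵘ-ℕtoℚ : ∀ k → toℚᵘ (ℕtoℚ k) ℚᵘ.≃ ℚᵘ.mkℚᵘ (ℤ.+ k) 0
toℚᵘ-ℕtoℚ k = toℚᵘ-fromℚᵘ (ℚᵘ.mkℚᵘ (ℤ.+ k) 0)

ℕtoℚ-+ : ∀ a b → ℕtoℚ (a ℕ.+ b) ≡ ℕtoℚ a + ℕtoℚ b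
ℕtoℚ-+ a b = toℚᵘ-injective (begin
  toℚᵘ (ℕtoℚ (a ℕ.+ b))                       ≈⟨ toℚᵘ-ℕtoℚ (a ℕ.+ b) ⟩
  ℚᵘ.mkℚᵘ (ℤ.+ (a ℕ.+ b)) 0                   ≈⟨ ℚᵘ.*≡* (numerators (ℤ.+ a) (ℤ.+ b) (ℤ.pos-+ a b)) ⟩
  ℚᵘ.mkℚᵘ (ℤ.+ a) 0 ℚᵘ.+ ℚᵘ.mkℚᵘ (ℤ.+ b) 0    ≈⟨ ℚᵘ.+-cong (toℚᵘ-ℕtoℚ a) (toℚᵘ-ℕtoℚ b) ⟨
  toℚᵘ (ℕtoℚ a) ℚᵘ.+ toℚᵘ (ℕtoℚ b)            ≈⟨ toℚᵘ-homo-+ (ℕtoℚ a) (ℕtoℚ b) ⟨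
  toℚᵘ (ℕtoℚ a + ℕtoℚ b)                      ∎)
  where
  open ℚᵘ.≃-Reasoning
  numerators : ∀ x y {z} → z ≡ x ℤ.+ y → z ℤ.* ℤ.+ 1 ≡ (x ℤ.* ℤ.+ 1 ℤ.+ y ℤ.* ℤ.+ 1) ℤ.* ℤ.+ 1
  numerators x y {z} z≡x+y = trans (ℤ.*-identityʳ z) (trans z≡x+y
    (sym (trans (ℤ.*-identityʳ _) (cong₂ ℤ._+_ (ℤ.*-identityʳ x) (ℤ.*-identityʳ y)))))

ℕtoℚ-suc : ∀ n → ℕtoℚ (suc n) ≡ 1ℚ + ℕtoℚ n
ℕtoℚ-suc = ℕtoℚ-+ 1

ℕtoℚ-* : ∀ a b → ℕtoℚ (a ℕ.* b) ≡ ℕtoℚ a * ℕtoℚ b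
ℕtoℚ-* zero b = sym (*-zeroˡ (ℕtoℚ b))
ℕtoℚ-* (suc a) b = begin
  ℕtoℚ (b ℕ.+ a ℕ.* b)          ≡⟨ ℕtoℚ-+ b (a ℕ.* b) ⟩
  ℕtoℚ b + ℕtoℚ (a ℕ.* b)       ≡⟨ cong₂ _+_ (sym (*-identityˡ (ℕtoℚ b))) (ℕtoℚ-* a b) ⟩
  1ℚ * ℕtoℚ b + ℕtoℚ a * ℕtoℚ b ≡⟨ *-distribʳ-+ (ℕtoℚ b) 1ℚ (ℕtoℚ a) ⟨
  (1ℚ + ℕtoℚ a) * ℕtoℚ b        ≡⟨ cong (_* ℕtoℚ b) (ℕtoℚ-suc a) ⟨
  ℕtoℚ (suc a) * ℕtoℚ b         ∎
  where open ≡-Reasoning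

ℕtoℚ-injective : ∀ a b → ℕtoℚ a ≡ ℕtoℚ b → a ≡ b
ℕtoℚ-injective a b eq with ℚᵘ.≃-trans (ℚᵘ.≃-sym (toℚᵘ-ℕtoℚ a)) (ℚᵘ.≃-trans (ℚᵘ.≃-reflexive (cong toℚᵘ eq)) (toℚᵘ-ℕtoℚ b))
... | ℚᵘ.*≡* a*1≡b*1 = ℤ.+-injective (trans (sym (ℤ.*-identityʳ (ℤ.+ a))) (trans a*1≡b*1 (ℤ.*-identityʳ (ℤ.+ b))))

inverse : (c : ℚ) → c ≢ 0ℚ → ℚ
inverse c c≢0 = (ℚ.1/ c) {{ℚ.≢-nonZero c≢0}}

inverse-*ˡ : ∀ c (c≢0 : c ≢ 0ℚ) → inverse c c≢0 * c ≡ 1ℚ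
inverse-*ˡ c c≢0 = *-inverseˡ c {{ℚ.≢-nonZero c≢0}}

*-≢0 : ∀ {a b} → a ≢ 0ℚ → b ≢ 0ℚ → a * b ≢ 0ℚ
*-≢0 {a} {b} a≢0 b≢0 ab≡0 = b≢0 (begin
  b                  ≡⟨ *-identityˡ b ⟨
  1ℚ * b             ≡⟨ cong (_* b) (inverse-*ˡ a a≢0) ⟨
  a⁻¹ * a * b        ≡⟨ *-assoc a⁻¹ a b ⟩
  a⁻¹ * (a * b)      ≡⟨ cong (a⁻¹ *_) ab≡0 ⟩
  a⁻¹ * 0ℚ           ≡⟨ *-zeroʳ a⁻¹ ⟩
  0ℚ                 ∎)
  where
  open ≡-Reasoning
  a⁻¹ = inverse a a≢0

ℕtoℚ-suc≢0 : ∀ k → ℕtoℚ (suc k) ≢ 0ℚ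
ℕtoℚ-suc≢0 k eq = ℕ.1+n≢0 (ℕtoℚ-injective (suc k) 0 eq)

ℕtoℚ-½≢0 : ∀ j → ℕtoℚ j - ½ ≢ 0ℚ
ℕtoℚ-½≢0 j eq = j+j≢1 j (ℕtoℚ-injective (j ℕ.+ j) 1 (begin
  ℕtoℚ (j ℕ.+ j)                  ≡⟨ ℕtoℚ-+ j j ⟩
  ℕtoℚ j + ℕtoℚ j                 ≡⟨ double (ℕtoℚ j) ⟩
  (1ℚ + 1ℚ) * (ℕtoℚ j - ½) + 1ℚ   ≡⟨ cong (λ x → (1ℚ + 1ℚ) * x + 1ℚ) eq ⟩
  1ℚ                              ∎))
  where
  open ≡-Reasoning
  double : ∀ x → x + x ≡ (1ℚ + 1ℚ) * (x - ½) + 1ℚ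
  double = solve 1 (λ x → x :+ x := (con 1ℚ :+ con 1ℚ) :* (x :- con ½) :+ con 1ℚ) refl
  j+j≢1 : ∀ j → j ℕ.+ j ≢ 1
  j+j≢1 (suc j) eq = ℕ.1+n≢0 (ℕ.suc-injective (trans (sym (ℕ.+-suc (suc j) j)) eq))

-- Coefficients of polynomial operations

Coeffs : Set
Coeffs = Mono → ℚ

whenPos : ℕ → ℚ → ℚ
whenPos zero x = 0ℚ
whenPos (suc _) x = x

whenZero : ℕ → ℚ → ℚ
whenZero zero x = x
whenZero (suc _) x = 0ℚ

whenPos-0 : ∀ e → whenPos e 0ℚ ≡ 0ℚ
whenPos-0 zero = refl
whenPos-0 (suc _) = refl

whenPos-+ : ∀ e x y → whenPos e (x + y) ≡ whenPos e x + whenPos e y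
whenPos-+ zero x y = sym (+-identityˡ 0ℚ)
whenPos-+ (suc _) x y = refl

whenPos-* : ∀ e c x → whenPos e (c * x) ≡ c * whenPos e x
whenPos-* zero c x = sym (*-zeroʳ c)
whenPos-* (suc _) c x = refl

whenZero-0 : ∀ e → whenZero e 0ℚ ≡ 0ℚ
whenZero-0 zero = refl
whenZero-0 (suc _) = refl

whenZero-+ : ∀ e x y → whenZero e (x + y) ≡ whenZero e x + whenZero e y
whenZero-+ zero x y = refl
whenZero-+ (suc _) x y = sym (+-identityˡ 0ℚ)

whenZero-* : ∀ e c x → whenZero e (c * x) ≡ c * whenZero e x
whenZero-* zero c x = refl
whenZero-* (suc _) c x = sym (*-zeroʳ c)

-- If F holds the coefficients of f, then mulQ j F holds those of Q_j f (with Q_0 = 1)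
-- and diff j F those of ∂f/∂Q_{j+1}.
mulQ : ℕ → Coeffs → Coeffs
mulQ zero F = F
mulQ (suc j) F m = whenPos (exponent m j) (F (lower j m))

diff : ℕ → Coeffs → Coeffs
diff j F m = ℕtoℚ (suc (exponent m j)) * F (raise j m)

raise∼⇒∼lower : ∀ j {a b} → raise j a ∼ b → a ∼ lower j b
raise∼⇒∼lower j {a} ra∼b = ∼-trans (∼-sym (lower-raise j a)) (lower-cong j ra∼b)

∼lower⇒raise∼ : ∀ j {a b} → 0 < exponent b j → a ∼ lower j b → raise j a ∼ b
∼lower⇒raise∼ j {b = b} pos a∼lb = ∼-trans (raise-cong j a∼lb) (raise-lower j b pos)

monoEq-raise : ∀ j a {b} → 0 < exponent b j → monoEq (raise j a) b ≡ monoEq a (lower j b)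
monoEq-raise j a pos = monoEq-≡ (raise∼⇒∼lower j) (∼lower⇒raise∼ j pos)

monoEq-lower : ∀ j {a} b → 0 < exponent a j → monoEq (lower j a) b ≡ monoEq a (raise j b)
monoEq-lower j {a} b pos = monoEq-≡
  (λ la∼b → ∼-trans (∼-sym (raise-lower j a pos)) (raise-cong j la∼b))
  (λ a∼rb → ∼-trans (lower-cong j a∼rb) (lower-raise j b))

monoEq-exponent : ∀ {a b} j → exponent a j ≢ exponent b j → monoEq a b ≡ false
monoEq-exponent {a} {b} j e≢ = monoEq-false {a} {b} λ a∼b → e≢ (exponent-≡ a∼b j)

monoEq-raise-0ˡ : ∀ j a {b} → exponent b j ≡ 0 → monoEq (raise j a) b ≡ false
monoEq-raise-0ˡ j a {b} e≡0 = monoEq-exponent {raise j a} {b} j λ eq →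
  ℕ.0≢1+n (trans (sym e≡0) (trans (sym eq) (exponent-raise j a)))

monoEq-raise-0ʳ : ∀ j {a} b → exponent a j ≡ 0 → monoEq a (raise j b) ≡ false
monoEq-raise-0ʳ j {a} b e≡0 = monoEq-exponent {a} {raise j b} j λ eq →
  ℕ.0≢1+n (trans (sym e≡0) (trans eq (exponent-raise j b)))

coeff-+ᴾ : ∀ p q m → coeff (p +ᴾ q) m ≡ coeff p m + coeff q m
coeff-+ᴾ [] q m = sym (+-identityˡ _)
coeff-+ᴾ ((c , m′) ∷ p) q m with monoEq m′ m
... | true = trans (cong (c +_) (coeff-+ᴾ p q m)) (sym (+-assoc c _ _))
... | false = coeff-+ᴾ p q m

coeff-scale : ∀ c p m → coeff (scale c p) m ≡ c * coeff p m
coeff-scale c [] m = sym (*-zeroʳ c)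
coeff-scale c ((d , m′) ∷ p) m with monoEq m′ m
... | true = trans (cong (c * d +_) (coeff-scale c p m)) (sym (*-distribˡ-+ c d _))
... | false = coeff-scale c p m

coeff-cong : ∀ p {a b} → a ∼ b → coeff p a ≡ coeff p b
coeff-cong [] a∼b = refl
coeff-cong ((c , m′) ∷ p) {a} {b} a∼b
  rewrite monoEq-≡ {m′} {a} (λ m′∼a → ∼-trans m′∼a a∼b) (λ m′∼b → ∼-trans m′∼b (∼-sym a∼b))
  = cong (λ x → if monoEq m′ b then c + x else x) (coeff-cong p a∼b)

coeff-Q*ᴾ : ∀ j p m → coeff (Q j *ᴾ p) m ≡ mulQ j (coeff p) m
coeff-Q*ᴾ zero [] m = refl
coeff-Q*ᴾ zero ((d , m′) ∷ p) m with monoEq m′ m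
... | true = cong₂ _+_ (*-identityˡ d) (coeff-Q*ᴾ zero p m)
... | false = coeff-Q*ᴾ zero p m
coeff-Q*ᴾ (suc j) [] m with exponent m j
... | zero = refl
... | suc _ = refl
coeff-Q*ᴾ (suc j) ((d , m′) ∷ p) m with exponent m j in e | coeff-Q*ᴾ (suc j) p m
... | zero | ih with monoEq (raise j m′) m | monoEq-raise-0ˡ j m′ {m} e
...   | _ | refl = ih
coeff-Q*ᴾ (suc j) ((d , m′) ∷ p) m | suc _ | ih
  with monoEq (raise j m′) m | monoEq-raise j m′ {m} (subst (0 <_) (sym e) (s≤s z≤n))
...   | _ | refl with monoEq m′ (lower j m)
...     | true = cong₂ _+_ (*-identityˡ d) ih
...     | false = ih

-- Both ∂/∂Q_{j+1} and division by Q₁ act term by term in this way.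
lowerTerms : ℕ → (ℕ → ℚ → ℚ) → Poly → Poly
lowerTerms j g = map λ { (c , m) → g (proj₁ (dMono j m)) c , lower j m }

coeff-lowerTerms : ∀ j (g : ℕ → ℚ → ℚ) →
  (∀ c → g 0 c ≡ 0ℚ) → (∀ e → g e 0ℚ ≡ 0ℚ) → (∀ e c x → g e (c + x) ≡ g e c + g e x) →
  ∀ p m → coeff (lowerTerms j g p) m ≡ g (suc (exponent m j)) (coeff p (raise j m))
coeff-lowerTerms j g g-0ˡ g-0ʳ g-+ [] m = sym (g-0ʳ _)
coeff-lowerTerms j g g-0ˡ g-0ʳ g-+ ((c , m′) ∷ p) m
  with proj₁ (dMono j m′) | exponent-dMono j m′ | coeff-lowerTerms j g g-0ˡ g-0ʳ g-+ p m
... | _ | refl | ih with exponent m′ j in e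
...   | zero with monoEq m′ (raise j m) | monoEq-raise-0ʳ j {m′} m e
...     | _ | refl with monoEq (lower j m′) m
...       | true = trans (cong (_+ coeff (lowerTerms j g p) m) (g-0ˡ c)) (trans (+-identityˡ _) ih)
...       | false = ih
coeff-lowerTerms j g g-0ˡ g-0ʳ g-+ ((c , m′) ∷ p) m | _ | refl | ih | suc _
  with monoEq (lower j m′) m | monoEq-lower j {m′} m (subst (0 <_) (sym e) (s≤s z≤n))
...   | _ | refl with monoEq m′ (raise j m) | monoEq-reflects m′ (raise j m)
...     | true | ofʸ m′∼rm rewrite ℕ.suc-injective (trans (sym e) (trans (exponent-≡ m′∼rm j) (exponent-raise j m)))
          = trans (cong (g (suc (exponent m j)) c +_) ih) (sym (g-+ _ c _))
...     | false | _ = ih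

coeff-deriv : ∀ j p m → coeff (deriv j p) m ≡ diff j (coeff p) m
coeff-deriv j p m = begin
  coeff (deriv j p) m
    ≡⟨ cong (λ q → coeff q m) (map-cong (λ { (c , m′) → refl }) p) ⟩
  coeff (lowerTerms j (λ e c → c * ℕtoℚ e) p) m
    ≡⟨ coeff-lowerTerms j (λ e c → c * ℕtoℚ e) (λ c → *-zeroʳ c) (λ e → *-zeroˡ (ℕtoℚ e))
                        (λ e c x → *-distribʳ-+ (ℕtoℚ e) c x) p m ⟩
  coeff p (raise j m) * ℕtoℚ (suc (exponent m j))
    ≡⟨ *-comm (coeff p (raise j m)) (ℕtoℚ (suc (exponent m j))) ⟩
  diff j (coeff p) m ∎
  where open ≡-Reasoning

coeff--ᴾ : ∀ p m → coeff (-ᴾ p) m ≡ - coeff p m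
coeff--ᴾ p m = trans (coeff-scale (- 1ℚ) p m)
  (trans (sym (neg-distribˡ-* 1ℚ (coeff p m))) (cong -_ (*-identityˡ (coeff p m))))

divQ₁ : Poly → Poly
divQ₁ = lowerTerms 0 whenPos

coeff-divQ₁ : ∀ p m → coeff (divQ₁ p) m ≡ coeff p (raise 0 m)
coeff-divQ₁ = coeff-lowerTerms 0 whenPos (λ _ → refl) whenPos-0 whenPos-+

withoutQ₁ : Poly → Poly
withoutQ₁ p = p +ᴾ -ᴾ (Q 1 *ᴾ divQ₁ p)

coeff-withoutQ₁ : ∀ p m → coeff (withoutQ₁ p) m ≡ whenZero (exponent m 0) (coeff p m)
coeff-withoutQ₁ p m = begin
  coeff (withoutQ₁ p) m
    ≡⟨ coeff-+ᴾ p _ m ⟩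
  coeff p m + coeff (-ᴾ (Q 1 *ᴾ divQ₁ p)) m
    ≡⟨ cong (coeff p m +_) (trans (coeff--ᴾ (Q 1 *ᴾ divQ₁ p) m) (cong -_ (coeff-Q*ᴾ 1 (divQ₁ p) m))) ⟩
  coeff p m - whenPos (exponent m 0) (coeff (divQ₁ p) (lower 0 m))
    ≡⟨ cancel (exponent m 0) refl ⟩
  whenZero (exponent m 0) (coeff p m) ∎
  where
  open ≡-Reasoning
  cancel : ∀ e → exponent m 0 ≡ e → coeff p m - whenPos e (coeff (divQ₁ p) (lower 0 m)) ≡ whenZero e (coeff p m)
  cancel zero _ = +-identityʳ (coeff p m)
  cancel (suc _) e = begin
    coeff p m - coeff (divQ₁ p) (lower 0 m)  ≡⟨ cong (λ x → coeff p m - x) (coeff-divQ₁ p (lower 0 m)) ⟩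
    coeff p m - coeff p (raise 0 (lower 0 m)) ≡⟨ cong (λ x → coeff p m - x) (coeff-cong p (raise-lower 0 m (subst (0 <_) (sym e) (s≤s z≤n)))) ⟩
    coeff p m - coeff p m                     ≡⟨ +-inverseʳ (coeff p m) ⟩
    0ℚ ∎

-- Finite sums and linear operators on coefficients

∑ : ℕ → (ℕ → ℚ) → ℚ
∑ zero f = 0ℚ
∑ (suc n) f = f 0 + ∑ n (f ∘ suc)

syntax ∑ n (λ j → e) = ∑[ j < n ] e

∑-cong : ∀ n {f g} → f ≗ g → ∑ n f ≡ ∑ n g
∑-cong zero f≗g = refl
∑-cong (suc n) f≗g = cong₂ _+_ (f≗g 0) (∑-cong n (f≗g ∘ suc))

∑-zero : ∀ n {f} → (∀ j → f j ≡ 0ℚ) → ∑ n f ≡ 0ℚ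
∑-zero zero f≡0 = refl
∑-zero (suc n) f≡0 = trans (cong₂ _+_ (f≡0 0) (∑-zero n (f≡0 ∘ suc))) (+-identityˡ 0ℚ)

∑-extend : ∀ {L M f} → L ≤ M → (∀ j → L ≤ j → f j ≡ 0ℚ) → ∑ M f ≡ ∑ L f
∑-extend {zero} {M} z≤n f≡0 = ∑-zero M λ j → f≡0 j z≤n
∑-extend {suc L} {suc M} {f} (s≤s L≤M) f≡0 = cong (f 0 +_) (∑-extend L≤M λ j L≤j → f≡0 (suc j) (s≤s L≤j))

∑-+ : ∀ n f g → ∑[ j < n ] (f j + g j) ≡ ∑ n f + ∑ n g
∑-+ zero f g = sym (+-identityˡ 0ℚ)
∑-+ (suc n) f g = trans (cong (f 0 + g 0 +_) (∑-+ n (f ∘ suc) (g ∘ suc)))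
  (CommSemigroupProps.interchange (CommutativeMonoid.commutativeSemigroup +-0-commutativeMonoid) (f 0) (g 0) _ _)

∑-+₃ : ∀ n f g h → ∑[ j < n ] (f j + (g j + h j)) ≡ ∑ n f + (∑ n g + ∑ n h)
∑-+₃ n f g h = trans (∑-+ n f _) (cong (∑ n f +_) (∑-+ n g h))

∑-*ˡ : ∀ n c f → ∑[ j < n ] (c * f j) ≡ c * ∑ n f
∑-*ˡ zero c f = sym (*-zeroʳ c)
∑-*ˡ (suc n) c f = trans (cong (c * f 0 +_) (∑-*ˡ n c (f ∘ suc))) (sym (*-distribˡ-+ c _ _))

∑-*ʳ : ∀ n c f → ∑[ j < n ] (f j * c) ≡ ∑ n f * c
∑-*ʳ n c f = trans (∑-cong n λ j → *-comm (f j) c) (trans (∑-*ˡ n c f) (*-comm c (∑ n f)))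

δ : ℕ → ℕ → ℚ → ℚ
δ j i x = if j ≡ᵇ i then x else 0ℚ

δ-diag : ∀ i x → δ i i x ≡ x
δ-diag zero x = refl
δ-diag (suc i) x = δ-diag i x

δ-off : ∀ {j i} x → j ≢ i → δ j i x ≡ 0ℚ
δ-off {zero} {zero} x j≢i = ⊥-elim (j≢i refl)
δ-off {zero} {suc i} x j≢i = refl
δ-off {suc j} {zero} x j≢i = refl
δ-off {suc j} {suc i} x j≢i = δ-off {j} {i} x (j≢i ∘ cong suc)

∑-δ : ∀ n i (f : ℕ → ℚ) → i < n → ∑[ j < n ] δ j i (f j) ≡ f i
∑-δ (suc n) zero f _ = trans (cong (f 0 +_) (∑-zero n {λ j → δ (suc j) 0 (f (suc j))} λ _ → refl)) (+-identityʳ (f 0))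
∑-δ (suc n) (suc i) f (s≤s i<n) = trans (+-identityˡ (∑[ j < n ] δ (suc j) (suc i) (f (suc j)))) (∑-δ n i (f ∘ suc) i<n)

∑-δ-out : ∀ n k i (f : ℕ → ℚ) → ∑[ l < n ] δ k i (f l) ≡ δ k i (∑ n f)
∑-δ-out n k i f with k ≡ᵇ i
... | true = refl
... | false = ∑-zero n λ _ → refl

δ-* : ∀ k i c x → c * δ k i x ≡ δ k i (c * x)
δ-* k i c x with k ≡ᵇ i
... | true = refl
... | false = *-zeroʳ c

record IsLinear (Φ : Coeffs → Coeffs) : Set where
  field
    ≗-cong : ∀ {F G} → F ≗ G → Φ F ≗ Φ G
    additive : ∀ F G → Φ (λ m → F m + G m) ≗ λ m → Φ F m + Φ G m
    homogeneous : ∀ c F → Φ (λ m → c * F m) ≗ λ m → c * Φ F m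

  zero-homo : Φ (λ _ → 0ℚ) ≗ λ _ → 0ℚ
  zero-homo m = trans (homogeneous 0ℚ (λ _ → 0ℚ) m) (*-zeroˡ (Φ (λ _ → 0ℚ) m))

  vanishes : ∀ {F} → F ≗ (λ _ → 0ℚ) → Φ F ≗ λ _ → 0ℚ
  vanishes F≡0 m = trans (≗-cong F≡0 m) (zero-homo m)

  δ-homo : ∀ k i F → Φ (λ m → δ k i (F m)) ≗ λ m → δ k i (Φ F m)
  δ-homo k i F with k ≡ᵇ i
  ... | true = λ _ → refl
  ... | false = zero-homo

  ∑-homo : ∀ n (G : ℕ → Coeffs) → Φ (λ m → ∑[ j < n ] G j m) ≗ λ m → ∑[ j < n ] Φ (G j) m
  ∑-homo zero G = zero-homo
  ∑-homo (suc n) G m = trans (additive (G 0) (λ m′ → ∑[ j < n ] G (suc j) m′) m)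
                             (cong (Φ (G 0) m +_) (∑-homo n (G ∘ suc) m))
open IsLinear

mulQ-linear : ∀ j → IsLinear (mulQ j)
mulQ-linear zero = record { ≗-cong = λ F≗G → F≗G ; additive = λ _ _ _ → refl ; homogeneous = λ _ _ _ → refl }
mulQ-linear (suc j) = record
  { ≗-cong = λ F≗G m → cong (whenPos (exponent m j)) (F≗G (lower j m))
  ; additive = λ F G m → whenPos-+ (exponent m j) _ _
  ; homogeneous = λ c F m → whenPos-* (exponent m j) c _
  }

diff-linear : ∀ j → IsLinear (diff j)
diff-linear j = record
  { ≗-cong = λ F≗G m → cong (ℕtoℚ (suc (exponent m j)) *_) (F≗G (raise j m))
  ; additive = λ F G m → *-distribˡ-+ (ℕtoℚ (suc (exponent m j))) _ _
  ; homogeneous = λ c F m → x*[c*y]≡c*[x*y] (ℕtoℚ (suc (exponent m j))) c _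
  }
  where
  x*[c*y]≡c*[x*y] : ∀ x c y → x * (c * y) ≡ c * (x * y)
  x*[c*y]≡c*[x*y] = solve 3 (λ x c y → x :* (c :* y) := c :* (x :* y)) refl

∘-linear : ∀ {Φ Ψ} → IsLinear Φ → IsLinear Ψ → IsLinear (Φ ∘ Ψ)
∘-linear {Φ} {Ψ} φ ψ = record
  { ≗-cong = ≗-cong φ ∘ ≗-cong ψ
  ; additive = λ F G → λ m → trans (≗-cong φ (additive ψ F G) m) (additive φ (Ψ F) (Ψ G) m)
  ; homogeneous = λ c F → λ m → trans (≗-cong φ (homogeneous ψ c F) m) (homogeneous φ c (Ψ F) m)
  }

scaled-linear : ∀ c {Φ} → IsLinear Φ → IsLinear (λ F m → c * Φ F m)
scaled-linear c {Φ} φ = record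
  { ≗-cong = λ F≗G m → cong (c *_) (≗-cong φ F≗G m)
  ; additive = λ F G m → trans (cong (c *_) (additive φ F G m)) (*-distribˡ-+ c _ _)
  ; homogeneous = λ d F m → trans (cong (c *_) (homogeneous φ d F m)) (c*[d*x]≡d*[c*x] c d _)
  }
  where
  c*[d*x]≡d*[c*x] : ∀ c d x → c * (d * x) ≡ d * (c * x)
  c*[d*x]≡d*[c*x] = solve 3 (λ c d x → c :* (d :* x) := d :* (c :* x)) refl

∑-linear : ∀ n {Φ : ℕ → Coeffs → Coeffs} → (∀ j → IsLinear (Φ j)) → IsLinear (λ F m → ∑[ j < n ] Φ j F m)
∑-linear n φ = record
  { ≗-cong = λ F≗G m → ∑-cong n λ j → ≗-cong (φ j) F≗G m
  ; additive = λ F G m → trans (∑-cong n λ j → additive (φ j) F G m) (∑-+ n _ _)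
  ; homogeneous = λ c F m → trans (∑-cong n λ j → homogeneous (φ j) c F m) (∑-*ˡ n c _)
  }

half-difference-linear : ∀ {Φ Ψ} → IsLinear Φ → IsLinear Ψ → IsLinear (λ F m → ½ * (Φ F m - Ψ F m))
half-difference-linear {Φ} {Ψ} φ ψ = record
  { ≗-cong = λ F≗G m → cong (½ *_) (cong₂ _-_ (≗-cong φ F≗G m) (≗-cong ψ F≗G m))
  ; additive = λ F G m → trans (cong (½ *_) (cong₂ _-_ (additive φ F G m) (additive ψ F G m)))
                  (split (Φ F m) (Φ G m) (Ψ F m) (Ψ G m))
  ; homogeneous = λ c F m → trans (cong (½ *_) (cong₂ _-_ (homogeneous φ c F m) (homogeneous ψ c F m)))
                     (pull c (Φ F m) (Ψ F m))
  }
  where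
  split : ∀ a b x y → ½ * ((a + b) - (x + y)) ≡ ½ * (a - x) + ½ * (b - y)
  split = solve 4 (λ a b x y → con ½ :* ((a :+ b) :- (x :+ y)) := con ½ :* (a :- x) :+ con ½ :* (b :- y)) refl
  pull : ∀ c a x → ½ * (c * a - c * x) ≡ c * (½ * (a - x))
  pull = solve 3 (λ c a x → con ½ :* (c :* a :- c :* x) := c :* (con ½ :* (a :- x))) refl

-- The operators 𝛛, 𝒟 and Δ on coefficients

coeff-sumP-applyUpTo : ∀ n (h : ℕ → ℕ) (g : ℕ → Poly) m →
  coeff (sumP (map g (applyUpTo h n))) m ≡ ∑[ j < n ] coeff (g (h j)) m
coeff-sumP-applyUpTo zero h g m = refl
coeff-sumP-applyUpTo (suc n) h g m =
  trans (coeff-+ᴾ (g (h 0)) _ m) (cong (coeff (g (h 0)) m +_) (coeff-sumP-applyUpTo n (h ∘ suc) g m))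

coeff-sumP : ∀ n (g : ℕ → Poly) m → coeff (sumP (map g (upTo n))) m ≡ ∑[ j < n ] coeff (g j) m
coeff-sumP n = coeff-sumP-applyUpTo n id

Supported : ℕ → Coeffs → Set
Supported L F = ∀ m j → L ≤ j → 0 < exponent m j → F m ≡ 0ℚ

exponent-beyond : ∀ m {j} → length m ≤ j → exponent m j ≡ 0
exponent-beyond [] _ = refl
exponent-beyond (e ∷ es) {suc j} (s≤s len≤j) = exponent-beyond es len≤j

coeff-supported : ∀ p → Supported (maxLen p) (coeff p)
coeff-supported [] m j _ _ = refl
coeff-supported ((c , m′) ∷ p) m j L≤j pos
  rewrite monoEq-exponent {m′} {m} j λ eq → ℕ.<⇒≢ pos (sym (trans (sym eq)
            (exponent-beyond m′ (ℕ.≤-trans (ℕ.m≤m⊔n (length m′) (maxLen p)) L≤j))))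
  = coeff-supported p m j (ℕ.≤-trans (ℕ.m≤n⊔m (length m′) (maxLen p)) L≤j) pos

Supported-mono : ∀ {L M F} → L ≤ M → Supported L F → Supported M F
Supported-mono L≤M supp m j M≤j = supp m j (ℕ.≤-trans L≤M M≤j)

diff-beyond : ∀ {L} j F → Supported L F → L ≤ j → diff j F ≗ λ _ → 0ℚ
diff-beyond j F supp L≤j m = trans
  (cong (ℕtoℚ (suc (exponent m j)) *_) (supp (raise j m) j L≤j (subst (0 <_) (sym (exponent-raise j m)) (s≤s z≤n))))
  (*-zeroʳ (ℕtoℚ (suc (exponent m j))))

Supported-diff : ∀ {L} j F → Supported L F → Supported L (diff j F)
Supported-diff j F supp m i L≤i pos = trans
  (cong (ℕtoℚ (suc (exponent m j)) *_) (supp (raise j m) i L≤i (ℕ.≤-trans pos (exponent-≤-raise j m i))))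
  (*-zeroʳ (ℕtoℚ (suc (exponent m j))))
  where
  exponent-≤-raise : ∀ j m i → exponent m i ≤ exponent (raise j m) i
  exponent-≤-raise j m i = ℕ.≤-trans (ℕ.m≤n+m (exponent m i) (exponent (unitMono j) i))
                                    (ℕ.≤-reflexive (sym (exponent-addMono (unitMono j) m i)))

-- Coefficient formulas for 𝛛, 𝒟 and Δ, with the sums over variables cut off at M;
-- the cut-off is harmless once F is Supported below M.
bdᶜ : ℕ → Coeffs → Coeffs
bdᶜ M F m = ∑[ j < M ] mulQ j (diff j F) m

binomial : ℕ → ℕ → ℚ
binomial k l = ℕtoℚ ((k ℕ.+ l) C k)

𝒟ᶜ : ℕ → Coeffs → Coeffs
𝒟ᶜ M F m = ∑[ k < M ] ∑[ l < M ] (binomial k l * mulQ (k ℕ.+ l) (diff k (diff l F)) m)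

Δᶜ : ℕ → Coeffs → Coeffs
Δᶜ M F m = ½ * (𝒟ᶜ M F m - bdᶜ M (bdᶜ M F) m)

bdᶜ-linear : ∀ M → IsLinear (bdᶜ M)
bdᶜ-linear M = ∑-linear M λ j → ∘-linear (mulQ-linear j) (diff-linear j)

𝒟ᶜ-linear : ∀ M → IsLinear (𝒟ᶜ M)
𝒟ᶜ-linear M = ∑-linear M λ k → ∑-linear M λ l →
  scaled-linear (binomial k l) (∘-linear (mulQ-linear (k ℕ.+ l)) (∘-linear (diff-linear k) (diff-linear l)))

Δᶜ-linear : ∀ M → IsLinear (Δᶜ M)
Δᶜ-linear M = half-difference-linear (𝒟ᶜ-linear M) (∘-linear (bdᶜ-linear M) (bdᶜ-linear M))

bdᶜ-extend : ∀ {L M} F → Supported L F → L ≤ M → bdᶜ M F ≗ bdᶜ L F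
bdᶜ-extend F supp L≤M m = ∑-extend L≤M λ j L≤j → vanishes (mulQ-linear j) (diff-beyond j F supp L≤j) m

𝒟ᶜ-extend : ∀ {L M} F → Supported L F → L ≤ M → 𝒟ᶜ M F ≗ 𝒟ᶜ L F
𝒟ᶜ-extend {L} {M} F supp L≤M m = trans
  (∑-cong M λ k → ∑-extend L≤M λ l L≤l → vanish k l (diff k (diff l F))
     (vanishes (diff-linear k) (diff-beyond l F supp L≤l)))
  (∑-extend L≤M λ k L≤k → ∑-zero L λ l → vanish k l (diff k (diff l F))
     (diff-beyond k (diff l F) (Supported-diff l F supp) L≤k))
  where
  vanish : ∀ k l G → G ≗ (λ _ → 0ℚ) → binomial k l * mulQ (k ℕ.+ l) G m ≡ 0ℚ
  vanish k l G G≡0 = trans (cong (binomial k l *_) (vanishes (mulQ-linear (k ℕ.+ l)) G≡0 m)) (*-zeroʳ (binomial k l))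

coeff-bd : ∀ {M} p → maxLen p ≤ M → coeff (bd p) ≗ bdᶜ M (coeff p)
coeff-bd {M} p len≤M m = begin
  coeff (bd p) m                                            ≡⟨ coeff-sumP L (λ j → Q j *ᴾ deriv j p) m ⟩
  ∑[ j < L ] coeff (Q j *ᴾ deriv j p) m                     ≡⟨ ∑-cong L (λ j → trans (coeff-Q*ᴾ j (deriv j p) m)
                                                                               (≗-cong (mulQ-linear j) (coeff-deriv j p) m)) ⟩
  bdᶜ L (coeff p) m                                         ≡⟨ bdᶜ-extend (coeff p) (coeff-supported p) len≤M m ⟨
  bdᶜ M (coeff p) m                                         ∎
  where
  open ≡-Reasoning
  L = maxLen p

coeff-𝒟 : ∀ {M} p → maxLen p ≤ M → coeff (𝒟 p) ≗ 𝒟ᶜ M (coeff p)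
coeff-𝒟 {M} p len≤M m = begin
  coeff (𝒟 p) m                                   ≡⟨ coeff-sumP L _ m ⟩
  ∑[ k < L ] coeff (sumP (map (term k) (upTo L))) m ≡⟨ ∑-cong L (λ k → trans (coeff-sumP L (term k) m) (∑-cong L (coeff-term k))) ⟩
  𝒟ᶜ L (coeff p) m                                ≡⟨ 𝒟ᶜ-extend (coeff p) (coeff-supported p) len≤M m ⟨
  𝒟ᶜ M (coeff p) m                                ∎
  where
  open ≡-Reasoning
  L = maxLen p
  term : ℕ → ℕ → Poly
  term k l = scale (binomial k l) (Q (k ℕ.+ l) *ᴾ deriv k (deriv l p))
  coeff-term : ∀ k l → coeff (term k l) m ≡ binomial k l * mulQ (k ℕ.+ l) (diff k (diff l (coeff p))) m
  coeff-term k l = trans (coeff-scale (binomial k l) (Q (k ℕ.+ l) *ᴾ deriv k (deriv l p)) m) (cong (binomial k l *_)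
    (trans (coeff-Q*ᴾ (k ℕ.+ l) (deriv k (deriv l p)) m)
           (≗-cong (mulQ-linear (k ℕ.+ l)) (λ m′ → trans (coeff-deriv k (deriv l p) m′) (≗-cong (diff-linear k) (coeff-deriv l p) m′)) m)))

cutoff : Poly → ℕ
cutoff p = maxLen p ⊔ maxLen (bd p)

coeff-Δ : ∀ {M} p → cutoff p ≤ M → coeff (Δ p) ≗ Δᶜ M (coeff p)
coeff-Δ {M} p cut≤M m = begin
  coeff (Δ p) m                                      ≡⟨ coeff-scale ½ (𝒟 p +ᴾ -ᴾ bd (bd p)) m ⟩
  ½ * coeff (𝒟 p +ᴾ -ᴾ bd (bd p)) m                  ≡⟨ cong (½ *_) (coeff-+ᴾ (𝒟 p) (-ᴾ bd (bd p)) m) ⟩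
  ½ * (coeff (𝒟 p) m + coeff (-ᴾ bd (bd p)) m)       ≡⟨ cong (λ x → ½ * (coeff (𝒟 p) m + x)) (coeff--ᴾ (bd (bd p)) m) ⟩
  ½ * (coeff (𝒟 p) m - coeff (bd (bd p)) m)          ≡⟨ cong (½ *_) (cong₂ _-_ (coeff-𝒟 p len≤M m) bd-bd) ⟩
  Δᶜ M (coeff p) m                                   ∎
  where
  open ≡-Reasoning
  len≤M = ℕ.≤-trans (ℕ.m≤m⊔n (maxLen p) (maxLen (bd p))) cut≤M
  bd-bd : coeff (bd (bd p)) m ≡ bdᶜ M (bdᶜ M (coeff p)) m
  bd-bd = trans (coeff-bd (bd p) (ℕ.≤-trans (ℕ.m≤n⊔m (maxLen p) (maxLen (bd p))) cut≤M) m)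
                (≗-cong (bdᶜ-linear M) (coeff-bd p len≤M) m)

-- F is homogeneous of weight b − a (and vanishes identically when b < a).
ShiftedHomogeneous : ℕ → ℕ → Coeffs → Set
ShiftedHomogeneous a b F = ∀ m → a ℕ.+ weight m ≢ b → F m ≡ 0ℚ

shifted-diff : ∀ a b k {F} → ShiftedHomogeneous a b F → ShiftedHomogeneous (a ℕ.+ suc k) b (diff k F)
shifted-diff a b k hom m ≢b = trans
  (cong (ℕtoℚ (suc (exponent m k)) *_) (hom (raise k m) λ eq → ≢b
    (trans (ℕ.+-assoc a (suc k) (weight m)) (trans (cong (a ℕ.+_) (sym (weight-raise k m))) eq))))
  (*-zeroʳ (ℕtoℚ (suc (exponent m k))))

shifted-mulQ : ∀ a b j {F} → ShiftedHomogeneous a b F → ShiftedHomogeneous a (b ℕ.+ j) (mulQ j F)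
shifted-mulQ a b zero {F} hom rewrite ℕ.+-identityʳ b = hom
shifted-mulQ a b (suc j) hom m ≢b+j with exponent m j in e
... | zero = refl
... | suc _ = hom (lower j m) λ eq → ≢b+j (begin
  a ℕ.+ weight m                          ≡⟨ cong (a ℕ.+_) (weight-lower j m (subst (0 <_) (sym e) (s≤s z≤n))) ⟨
  a ℕ.+ (suc j ℕ.+ weight (lower j m))    ≡⟨ cong (a ℕ.+_) (ℕ.+-comm (suc j) (weight (lower j m))) ⟩
  a ℕ.+ (weight (lower j m) ℕ.+ suc j)    ≡⟨ ℕ.+-assoc a (weight (lower j m)) (suc j) ⟨
  a ℕ.+ weight (lower j m) ℕ.+ suc j      ≡⟨ cong (ℕ._+ suc j) eq ⟩
  b ℕ.+ suc j                             ∎)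
  where open ≡-Reasoning

shifted-cancel : ∀ a b k {F} → ShiftedHomogeneous (a ℕ.+ k) (b ℕ.+ k) F → ShiftedHomogeneous a b F
shifted-cancel a b k hom m ≢b = hom m λ eq → ≢b (ℕ.+-cancelʳ-≡ k (a ℕ.+ weight m) b
  (trans (ℕ.+-assoc a (weight m) k) (trans (cong (a ℕ.+_) (ℕ.+-comm (weight m) k)) (trans (sym (ℕ.+-assoc a k (weight m))) eq))))

shifted-∑ : ∀ a b n (G : ℕ → Coeffs) → (∀ j → ShiftedHomogeneous a b (G j)) →
  ShiftedHomogeneous a b (λ m → ∑[ j < n ] G j m)
shifted-∑ a b n G hom m ≢b = ∑-zero n λ j → hom j m ≢b

shifted-bdᶜ : ∀ a b M {F} → ShiftedHomogeneous a b F → ShiftedHomogeneous (suc a) b (bdᶜ M F)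
shifted-bdᶜ a b M {F} hom = shifted-∑ (suc a) b M (λ j → mulQ j (diff j F)) λ j →
  shifted-cancel (suc a) b j (subst (λ a′ → ShiftedHomogeneous a′ (b ℕ.+ j) (mulQ j (diff j F))) (ℕ.+-suc a j)
    (shifted-mulQ (a ℕ.+ suc j) b j (shifted-diff a b j hom)))

shifted-𝒟ᶜ : ∀ a b M {F} → ShiftedHomogeneous a b F → ShiftedHomogeneous (2 ℕ.+ a) b (𝒟ᶜ M F)
shifted-𝒟ᶜ a b M {F} hom = shifted-∑ _ b M _ λ k → shifted-∑ _ b M _ λ l m ≢b →
  trans (cong (binomial k l *_) (shifted-cancel (2 ℕ.+ a) b (k ℕ.+ l)
          (subst (λ a′ → ShiftedHomogeneous a′ (b ℕ.+ (k ℕ.+ l)) (mulQ (k ℕ.+ l) (diff k (diff l F)))) (rearrange k l)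
            (shifted-mulQ (a ℕ.+ suc l ℕ.+ suc k) b (k ℕ.+ l) (shifted-diff (a ℕ.+ suc l) b k (shifted-diff a b l hom)))) m ≢b))
        (*-zeroʳ (binomial k l))
  where
  rearrange : ∀ k l → a ℕ.+ suc l ℕ.+ suc k ≡ 2 ℕ.+ a ℕ.+ (k ℕ.+ l)
  rearrange k l = trans (ℕ.+-suc (a ℕ.+ suc l) k) (cong suc (trans (cong (ℕ._+ k) (ℕ.+-suc a l))
    (cong suc (trans (ℕ.+-assoc a l k) (cong (a ℕ.+_) (ℕ.+-comm l k))))))

shifted-Δᶜ : ∀ a b M {F} → ShiftedHomogeneous a b F → ShiftedHomogeneous (2 ℕ.+ a) b (Δᶜ M F)
shifted-Δᶜ a b M {F} hom m ≢b = trans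
  (cong (½ *_) (cong₂ _-_ (shifted-𝒟ᶜ a b M hom m ≢b) (shifted-bdᶜ (suc a) b M (shifted-bdᶜ a b M hom) m ≢b)))
  (*-zeroʳ ½)

-- The commutator of Δ and Q₂

Respects∼ : Coeffs → Set
Respects∼ F = ∀ {a b} → a ∼ b → F a ≡ F b

mulQ-respects : ∀ j {F} → Respects∼ F → Respects∼ (mulQ j F)
mulQ-respects zero resp a∼b = resp a∼b
mulQ-respects (suc j) resp {a} {b} a∼b = cong₂ whenPos (exponent-≡ a∼b j) (resp (lower-cong j a∼b))

diff-respects : ∀ j {F} → Respects∼ F → Respects∼ (diff j F)
diff-respects j resp a∼b = cong₂ (λ e x → ℕtoℚ (suc e) * x) (exponent-≡ a∼b j) (resp (raise-cong j a∼b))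

bdᶜ-respects : ∀ M {F} → Respects∼ F → Respects∼ (bdᶜ M F)
bdᶜ-respects M resp a∼b = ∑-cong M λ j → mulQ-respects j (diff-respects j resp) a∼b

diff-mulQ : ∀ i j {F} → Respects∼ F → diff j (mulQ (suc i) F) ≗ λ m → δ j i (F m) + mulQ (suc i) (diff j F) m
diff-mulQ i j {F} resp m with j ℕ.≟ i
... | no j≢i rewrite δ-off (F m) j≢i | exponent-raise-other j m j≢i | exponent-lower-other i m (j≢i ∘ sym)
                   | resp (lower-raise-comm i j m (j≢i ∘ sym)) =
  trans (sym (whenPos-* (exponent m i) (ℕtoℚ (suc (exponent m j))) _)) (sym (+-identityˡ _))
... | yes refl rewrite δ-diag i (F m) | exponent-raise i m =
  trans (cong (ℕtoℚ (suc (exponent m i)) *_) (resp (lower-raise i m))) (product-rule (exponent m i) refl)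
  where
  product-rule : ∀ e → exponent m i ≡ e →
    ℕtoℚ (suc (exponent m i)) * F m ≡ F m + whenPos (exponent m i) (ℕtoℚ (suc (exponent (lower i m) i)) * F (raise i (lower i m)))
  product-rule zero e rewrite e = trans (*-identityˡ (F m)) (sym (+-identityʳ (F m)))
  product-rule (suc e′) e rewrite e | exponent-lower i m | e | resp (raise-lower i m (subst (0 <_) (sym e) (s≤s z≤n))) =
    trans (cong (_* F m) (ℕtoℚ-suc (suc e′)))
          (trans (*-distribʳ-+ (F m) 1ℚ (ℕtoℚ (suc e′))) (cong (_+ ℕtoℚ (suc e′) * F m) (*-identityˡ (F m))))

whenPos-comm : ∀ a b x → whenPos a (whenPos b x) ≡ whenPos b (whenPos a x)
whenPos-comm zero zero x = refl
whenPos-comm zero (suc b) x = refl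
whenPos-comm (suc a) zero x = refl
whenPos-comm (suc a) (suc b) x = refl

mulQ-mulQ-comm : ∀ i j {G} → Respects∼ G → mulQ j (mulQ (suc i) G) ≗ mulQ (suc i) (mulQ j G)
mulQ-mulQ-comm i zero resp m = refl
mulQ-mulQ-comm i (suc j) resp m with j ℕ.≟ i
... | yes refl = refl
... | no j≢i rewrite exponent-lower-other j m j≢i | exponent-lower-other i m (j≢i ∘ sym) =
  trans (cong (whenPos (exponent m j) ∘ whenPos (exponent m i)) (resp (lower-lower-comm i j m)))
        (whenPos-comm (exponent m j) (exponent m i) _)

bdᶜ-mulQ : ∀ i M {F} → Respects∼ F → i < M →
  bdᶜ M (mulQ (suc i) F) ≗ λ m → mulQ i F m + mulQ (suc i) (bdᶜ M F) m
bdᶜ-mulQ i M {F} resp i<M m = begin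
  ∑[ j < M ] mulQ j (diff j (mulQ (suc i) F)) m
    ≡⟨ ∑-cong M (λ j → ≗-cong (mulQ-linear j) (diff-mulQ i j resp) m) ⟩
  ∑[ j < M ] mulQ j (λ m′ → δ j i (F m′) + mulQ (suc i) (diff j F) m′) m
    ≡⟨ ∑-cong M (λ j → trans (additive (mulQ-linear j) _ _ m)
                              (cong₂ _+_ (δ-homo (mulQ-linear j) j i F m) (mulQ-mulQ-comm i j (diff-respects j resp) m))) ⟩
  ∑[ j < M ] (δ j i (mulQ j F m) + mulQ (suc i) (mulQ j (diff j F)) m)
    ≡⟨ ∑-+ M _ _ ⟩
  ∑[ j < M ] δ j i (mulQ j F m) + ∑[ j < M ] mulQ (suc i) (mulQ j (diff j F)) m
    ≡⟨ cong₂ _+_ (∑-δ M i (λ j → mulQ j F m) i<M) (sym (∑-homo (mulQ-linear (suc i)) M (λ j → mulQ j (diff j F)) m)) ⟩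
  mulQ i F m + mulQ (suc i) (bdᶜ M F) m ∎
  where open ≡-Reasoning

diff-diff-mulQ : ∀ i k l {F} → Respects∼ F → diff k (diff l (mulQ (suc i) F)) ≗
  λ m → δ l i (diff k F m) + (δ k i (diff l F m) + mulQ (suc i) (diff k (diff l F)) m)
diff-diff-mulQ i k l {F} resp m = begin
  diff k (diff l (mulQ (suc i) F)) m
    ≡⟨ ≗-cong (diff-linear k) (diff-mulQ i l resp) m ⟩
  diff k (λ m′ → δ l i (F m′) + mulQ (suc i) (diff l F) m′) m
    ≡⟨ additive (diff-linear k) (λ m′ → δ l i (F m′)) (mulQ (suc i) (diff l F)) m ⟩
  diff k (λ m′ → δ l i (F m′)) m + diff k (mulQ (suc i) (diff l F)) m
    ≡⟨ cong₂ _+_ (δ-homo (diff-linear k) l i F m) (diff-mulQ i k (diff-respects l resp) m) ⟩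
  δ l i (diff k F m) + (δ k i (diff l F m) + mulQ (suc i) (diff k (diff l F)) m) ∎
  where open ≡-Reasoning

mulQ-diff-diff-mulQ₂ : ∀ k l {F} → Respects∼ F → mulQ (k ℕ.+ l) (diff k (diff l (mulQ 2 F))) ≗ λ m →
  δ l 1 (mulQ (k ℕ.+ l) (diff k F) m) + (δ k 1 (mulQ (k ℕ.+ l) (diff l F) m) + mulQ 2 (mulQ (k ℕ.+ l) (diff k (diff l F))) m)
mulQ-diff-diff-mulQ₂ k l {F} resp m = begin
  mulQ t (diff k (diff l (mulQ 2 F))) m
    ≡⟨ ≗-cong (mulQ-linear t) (diff-diff-mulQ 1 k l resp) m ⟩
  mulQ t (λ m′ → δ l 1 (diff k F m′) + (δ k 1 (diff l F m′) + mulQ 2 (diff k (diff l F)) m′)) m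
    ≡⟨ additive (mulQ-linear t) (λ m′ → δ l 1 (diff k F m′)) (λ m′ → δ k 1 (diff l F m′) + mulQ 2 (diff k (diff l F)) m′) m ⟩
  mulQ t (λ m′ → δ l 1 (diff k F m′)) m + mulQ t (λ m′ → δ k 1 (diff l F m′) + mulQ 2 (diff k (diff l F)) m′) m
    ≡⟨ cong (mulQ t (λ m′ → δ l 1 (diff k F m′)) m +_) (additive (mulQ-linear t) (λ m′ → δ k 1 (diff l F m′)) (mulQ 2 (diff k (diff l F))) m) ⟩
  mulQ t (λ m′ → δ l 1 (diff k F m′)) m + (mulQ t (λ m′ → δ k 1 (diff l F m′)) m + mulQ t (mulQ 2 (diff k (diff l F))) m)
    ≡⟨ cong₂ _+_ (δ-homo (mulQ-linear t) l 1 (diff k F) m)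
                 (cong₂ _+_ (δ-homo (mulQ-linear t) k 1 (diff l F) m) (mulQ-mulQ-comm 1 t (diff-respects k (diff-respects l resp)) m)) ⟩
  δ l 1 (mulQ t (diff k F) m) + (δ k 1 (mulQ t (diff l F) m) + mulQ 2 (mulQ t (diff k (diff l F))) m) ∎
  where
  open ≡-Reasoning
  t = k ℕ.+ l

binomial-k1 : ∀ k → binomial k 1 ≡ ℕtoℚ (suc k)
binomial-k1 k = cong ℕtoℚ (trans (cong (_C k) (ℕ.+-comm k 1))
  (trans (nCk≡nC[n∸k] (ℕ.n≤1+n k)) (trans (cong (suc k C_) (ℕ.m+n∸n≡m 1 k)) (nC1≡n (suc k)))))

binomial-1l : ∀ l → binomial 1 l ≡ ℕtoℚ (suc l)
binomial-1l l = cong ℕtoℚ (nC1≡n (suc l))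

euler : ℕ → Coeffs → Coeffs
euler M F m = ∑[ k < M ] (ℕtoℚ (suc k) * mulQ (suc k) (diff k F) m)

∑∑-δ-second : ∀ M F m → 1 < M →
  ∑[ k < M ] ∑[ l < M ] δ l 1 (binomial k l * mulQ (k ℕ.+ l) (diff k F) m) ≡ euler M F m
∑∑-δ-second M F m 1<M = ∑-cong M λ k →
  trans (∑-δ M 1 (λ l → binomial k l * mulQ (k ℕ.+ l) (diff k F) m) 1<M)
        (cong₂ _*_ (binomial-k1 k) (cong (λ t → mulQ t (diff k F) m) (ℕ.+-comm k 1)))

∑∑-δ-first : ∀ M F m → 1 < M →
  ∑[ k < M ] ∑[ l < M ] δ k 1 (binomial k l * mulQ (k ℕ.+ l) (diff l F) m) ≡ euler M F m
∑∑-δ-first M F m 1<M = begin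
  ∑[ k < M ] ∑[ l < M ] δ k 1 (binomial k l * mulQ (k ℕ.+ l) (diff l F) m)
    ≡⟨ ∑-cong M (λ k → ∑-δ-out M k 1 (λ l → binomial k l * mulQ (k ℕ.+ l) (diff l F) m)) ⟩
  ∑[ k < M ] δ k 1 (∑[ l < M ] (binomial k l * mulQ (k ℕ.+ l) (diff l F) m))
    ≡⟨ ∑-δ M 1 (λ k → ∑[ l < M ] (binomial k l * mulQ (k ℕ.+ l) (diff l F) m)) 1<M ⟩
  ∑[ l < M ] (binomial 1 l * mulQ (suc l) (diff l F) m)
    ≡⟨ ∑-cong M (λ l → cong (_* mulQ (suc l) (diff l F) m) (binomial-1l l)) ⟩
  euler M F m ∎
  where open ≡-Reasoning

mulQ₂-𝒟ᶜ : ∀ M F m → mulQ 2 (𝒟ᶜ M F) m ≡ ∑[ k < M ] ∑[ l < M ] (binomial k l * mulQ 2 (mulQ (k ℕ.+ l) (diff k (diff l F))) m)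
mulQ₂-𝒟ᶜ M F m = trans (∑-homo (mulQ-linear 2) M (λ k m′ → ∑[ l < M ] term k l m′) m) (∑-cong M λ k →
  trans (∑-homo (mulQ-linear 2) M (term k) m) (∑-cong M λ l → homogeneous (mulQ-linear 2) (binomial k l) (mulQ (k ℕ.+ l) (diff k (diff l F))) m))
  where
  term : ℕ → ℕ → Coeffs
  term k l m′ = binomial k l * mulQ (k ℕ.+ l) (diff k (diff l F)) m′

𝒟ᶜ-mulQ₂ : ∀ M {F} → Respects∼ F → 1 < M →
  𝒟ᶜ M (mulQ 2 F) ≗ λ m → euler M F m + (euler M F m + mulQ 2 (𝒟ᶜ M F) m)
𝒟ᶜ-mulQ₂ M {F} resp 1<M m = begin
  ∑[ k < M ] ∑[ l < M ] (binomial k l * mulQ (k ℕ.+ l) (diff k (diff l (mulQ 2 F))) m)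
    ≡⟨ ∑-cong M (λ k → ∑-cong M λ l → trans (cong (binomial k l *_) (mulQ-diff-diff-mulQ₂ k l resp m)) (distribute (binomial k l) k l _ _ _)) ⟩
  ∑[ k < M ] ∑[ l < M ] (X k l + (Y k l + Z k l))
    ≡⟨ trans (∑-cong M (λ k → ∑-+₃ M (X k) (Y k) (Z k))) (∑-+₃ M _ _ _) ⟩
  ∑[ k < M ] ∑ M (X k) + (∑[ k < M ] ∑ M (Y k) + ∑[ k < M ] ∑ M (Z k))
    ≡⟨ cong₂ _+_ (∑∑-δ-second M F m 1<M) (cong₂ _+_ (∑∑-δ-first M F m 1<M) (sym (mulQ₂-𝒟ᶜ M F m))) ⟩
  euler M F m + (euler M F m + mulQ 2 (𝒟ᶜ M F) m) ∎
  where
  open ≡-Reasoning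
  X Y Z : ℕ → ℕ → ℚ
  X k l = δ l 1 (binomial k l * mulQ (k ℕ.+ l) (diff k F) m)
  Y k l = δ k 1 (binomial k l * mulQ (k ℕ.+ l) (diff l F) m)
  Z k l = binomial k l * mulQ 2 (mulQ (k ℕ.+ l) (diff k (diff l F))) m
  distribute : ∀ b k l x y z → b * (δ l 1 x + (δ k 1 y + z)) ≡ δ l 1 (b * x) + (δ k 1 (b * y) + b * z)
  distribute b k l x y z = trans (*-distribˡ-+ b _ _)
    (cong₂ _+_ (δ-* l 1 b x) (trans (*-distribˡ-+ b _ _) (cong (_+ b * z) (δ-* k 1 b y))))

ℕtoℚ-weightFrom : ∀ i m {K} → length m ≤ K →
  ℕtoℚ (weightFrom i m) ≡ ∑[ k < K ] (ℕtoℚ (i ℕ.+ k) * ℕtoℚ (exponent m k))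
ℕtoℚ-weightFrom i [] {K} _ = sym (∑-zero K λ k → *-zeroʳ (ℕtoℚ (i ℕ.+ k)))
ℕtoℚ-weightFrom i (e ∷ es) {suc K} (s≤s len≤K) = begin
  ℕtoℚ (i ℕ.* e ℕ.+ weightFrom (suc i) es)
    ≡⟨ trans (ℕtoℚ-+ (i ℕ.* e) _) (cong₂ _+_ (ℕtoℚ-* i e) (ℕtoℚ-weightFrom (suc i) es len≤K)) ⟩
  ℕtoℚ i * ℕtoℚ e + ∑[ k < K ] (ℕtoℚ (suc i ℕ.+ k) * ℕtoℚ (exponent es k))
    ≡⟨ cong₂ _+_ (cong (λ j → ℕtoℚ j * ℕtoℚ e) (sym (ℕ.+-identityʳ i)))
                 (∑-cong K λ k → cong (λ j → ℕtoℚ j * ℕtoℚ (exponent es k)) (sym (ℕ.+-suc i k))) ⟩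
  ℕtoℚ (i ℕ.+ 0) * ℕtoℚ e + ∑[ k < K ] (ℕtoℚ (i ℕ.+ suc k) * ℕtoℚ (exponent es k)) ∎
  where open ≡-Reasoning

mulQ-diff-self : ∀ k {F} → Respects∼ F → ∀ m → mulQ (suc k) (diff k F) m ≡ ℕtoℚ (exponent m k) * F m
mulQ-diff-self k {F} resp m = go (exponent m k) refl
  where
  go : ∀ e → exponent m k ≡ e → mulQ (suc k) (diff k F) m ≡ ℕtoℚ (exponent m k) * F m
  go zero e rewrite e = sym (*-zeroˡ (F m))
  go (suc _) e rewrite e | exponent-lower k m | e | resp (raise-lower k m (subst (0 <_) (sym e) (s≤s z≤n))) = refl

euler-weight : ∀ M {F} → Respects∼ F → Supported M F → ∀ m → euler M F m ≡ ℕtoℚ (weight m) * F m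
euler-weight M {F} resp supp m = begin
  ∑[ k < M ] (ℕtoℚ (suc k) * mulQ (suc k) (diff k F) m)
    ≡⟨ ∑-cong M (λ k → cong (ℕtoℚ (suc k) *_) (mulQ-diff-self k resp m)) ⟩
  ∑[ k < M ] (ℕtoℚ (suc k) * (ℕtoℚ (exponent m k) * F m))
    ≡⟨ ∑-extend (ℕ.m≤m⊔n M (length m)) beyond ⟨
  ∑[ k < K ] (ℕtoℚ (suc k) * (ℕtoℚ (exponent m k) * F m))
    ≡⟨ ∑-cong K (λ k → sym (*-assoc (ℕtoℚ (suc k)) (ℕtoℚ (exponent m k)) (F m))) ⟩
  ∑[ k < K ] (ℕtoℚ (suc k) * ℕtoℚ (exponent m k) * F m)
    ≡⟨ ∑-*ʳ K (F m) _ ⟩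
  ∑[ k < K ] (ℕtoℚ (suc k) * ℕtoℚ (exponent m k)) * F m
    ≡⟨ cong (_* F m) (ℕtoℚ-weightFrom 1 m (ℕ.m≤n⊔m M (length m))) ⟨
  ℕtoℚ (weight m) * F m ∎
  where
  open ≡-Reasoning
  K = M ⊔ length m
  beyond : ∀ k → M ≤ k → ℕtoℚ (suc k) * (ℕtoℚ (exponent m k) * F m) ≡ 0ℚ
  beyond k M≤k with exponent m k in e
  ... | zero = trans (cong (ℕtoℚ (suc k) *_) (*-zeroˡ (F m))) (*-zeroʳ (ℕtoℚ (suc k)))
  ... | suc e′ rewrite supp m k M≤k (subst (0 <_) (sym e) (s≤s z≤n)) =
    trans (cong (ℕtoℚ (suc k) *_) (*-zeroʳ (ℕtoℚ (suc e′)))) (*-zeroʳ (ℕtoℚ (suc k)))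

HomogeneousOf : ℕ → Coeffs → Set
HomogeneousOf = ShiftedHomogeneous 0

euler-homogeneous : ∀ n M {F} → Respects∼ F → Supported M F → HomogeneousOf n F → ∀ m → euler M F m ≡ ℕtoℚ n * F m
euler-homogeneous n M {F} resp supp hom m with weight m ℕ.≟ n
... | yes refl = euler-weight M resp supp m
... | no w≢n = trans (euler-weight M resp supp m) (*-zero-cong (ℕtoℚ (weight m)) (ℕtoℚ n) (hom m w≢n))
  where
  *-zero-cong : ∀ a b {x} → x ≡ 0ℚ → a * x ≡ b * x
  *-zero-cong a b refl = trans (*-zeroʳ a) (sym (*-zeroʳ b))

-- 𝒟 (Q₂ F) = 2n F + Q₂ 𝒟 F by Euler's identity, and 𝛛 𝛛 (Q₂ F) = F + 2 Q₁ 𝛛 F + Q₂ 𝛛 𝛛 F.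
Δᶜ-mulQ₂ : ∀ n M {F} → Respects∼ F → Supported M F → 1 < M → HomogeneousOf n F →
  Δᶜ M (mulQ 2 F) ≗ λ m → mulQ 2 (Δᶜ M F) m + (ℕtoℚ n - ½) * F m - mulQ 1 (bdᶜ M F) m
Δᶜ-mulQ₂ n M {F} resp supp 1<M hom m = begin
  ½ * (𝒟ᶜ M (mulQ 2 F) m - bdᶜ M (bdᶜ M (mulQ 2 F)) m)
    ≡⟨ cong (½ *_) (cong₂ _-_ 𝒟-part bd-bd-part) ⟩
  ½ * ((ℕtoℚ n * F m + (ℕtoℚ n * F m + mulQ 2 (𝒟ᶜ M F) m)) - ((F m + Q₁bdF) + (Q₁bdF + mulQ 2 (bdᶜ M (bdᶜ M F)) m)))
    ≡⟨ regroup (ℕtoℚ n) (F m) (mulQ 2 (𝒟ᶜ M F) m) Q₁bdF (mulQ 2 (bdᶜ M (bdᶜ M F)) m) ⟩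
  ½ * (mulQ 2 (𝒟ᶜ M F) m - mulQ 2 (bdᶜ M (bdᶜ M F)) m) + (ℕtoℚ n - ½) * F m - Q₁bdF
    ≡⟨ cong (λ x → x + (ℕtoℚ n - ½) * F m - Q₁bdF) mulQ₂-Δᶜ ⟨
  mulQ 2 (Δᶜ M F) m + (ℕtoℚ n - ½) * F m - Q₁bdF ∎
  where
  open ≡-Reasoning
  Q₁bdF = mulQ 1 (bdᶜ M F) m
  𝒟-part : 𝒟ᶜ M (mulQ 2 F) m ≡ ℕtoℚ n * F m + (ℕtoℚ n * F m + mulQ 2 (𝒟ᶜ M F) m)
  𝒟-part = trans (𝒟ᶜ-mulQ₂ M resp 1<M m)
    (cong₂ (λ x y → x + (y + mulQ 2 (𝒟ᶜ M F) m)) (euler-homogeneous n M resp supp hom m) (euler-homogeneous n M resp supp hom m))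
  bd-bd-part : bdᶜ M (bdᶜ M (mulQ 2 F)) m ≡ (F m + Q₁bdF) + (Q₁bdF + mulQ 2 (bdᶜ M (bdᶜ M F)) m)
  bd-bd-part = begin
    bdᶜ M (bdᶜ M (mulQ 2 F)) m
      ≡⟨ ≗-cong (bdᶜ-linear M) (bdᶜ-mulQ 1 M resp 1<M) m ⟩
    bdᶜ M (λ m′ → mulQ 1 F m′ + mulQ 2 (bdᶜ M F) m′) m
      ≡⟨ additive (bdᶜ-linear M) (mulQ 1 F) (mulQ 2 (bdᶜ M F)) m ⟩
    bdᶜ M (mulQ 1 F) m + bdᶜ M (mulQ 2 (bdᶜ M F)) m
      ≡⟨ cong₂ _+_ (bdᶜ-mulQ 0 M resp (ℕ.<-trans (s≤s z≤n) 1<M) m) (bdᶜ-mulQ 1 M (bdᶜ-respects M resp) 1<M m) ⟩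
    (F m + Q₁bdF) + (Q₁bdF + mulQ 2 (bdᶜ M (bdᶜ M F)) m) ∎
  mulQ₂-Δᶜ : mulQ 2 (Δᶜ M F) m ≡ ½ * (mulQ 2 (𝒟ᶜ M F) m - mulQ 2 (bdᶜ M (bdᶜ M F)) m)
  mulQ₂-Δᶜ with exponent m 1
  ... | zero = refl
  ... | suc _ = refl
  regroup : ∀ n f a b c → ½ * ((n * f + (n * f + a)) - ((f + b) + (b + c))) ≡ ½ * (a - c) + (n - ½) * f - b
  regroup = solve 5 (λ n f a b c → con ½ :* ((n :* f :+ (n :* f :+ a)) :- ((f :+ b) :+ (b :+ c)))
                                  := con ½ :* (a :- c) :+ (n :- con ½) :* f :- b) refl

-- Polynomials up to equality of coefficients

infix 4 _≋_
record _≋_ (p q : Poly) : Set where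
  constructor mk≋
  field coeff-≗ : p ≈ q
open _≋_

≋-setoid : Setoid 0ℓ 0ℓ
≋-setoid = record
  { Carrier = Poly
  ; _≈_ = _≋_
  ; isEquivalence = record
    { refl = mk≋ λ _ → refl
    ; sym = λ p≋q → mk≋ λ m → sym (coeff-≗ p≋q m)
    ; trans = λ p≋q q≋r → mk≋ λ m → trans (coeff-≗ p≋q m) (coeff-≗ q≋r m)
    }
  }

open Setoid ≋-setoid using () renaming (refl to ≋-refl; sym to ≋-sym; trans to ≋-trans)
module ≋-Reasoning = SetoidReasoning ≋-setoid

infixl 6 _−ᴾ_
_−ᴾ_ : Poly → Poly → Poly
p −ᴾ q = p +ᴾ -ᴾ q

coeff-−ᴾ : ∀ p q m → coeff (p −ᴾ q) m ≡ coeff p m - coeff q m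
coeff-−ᴾ p q m = trans (coeff-+ᴾ p (-ᴾ q) m) (cong (coeff p m +_) (coeff--ᴾ q m))

+ᴾ-cong : ∀ {p p′ q q′} → p ≋ p′ → q ≋ q′ → p +ᴾ q ≋ p′ +ᴾ q′
+ᴾ-cong {p} {p′} {q} {q′} p≋p′ q≋q′ = mk≋ λ m → trans (coeff-+ᴾ p q m)
  (trans (cong₂ _+_ (coeff-≗ p≋p′ m) (coeff-≗ q≋q′ m)) (sym (coeff-+ᴾ p′ q′ m)))

scale-cong : ∀ c {p q} → p ≋ q → scale c p ≋ scale c q
scale-cong c {p} {q} p≋q = mk≋ λ m → trans (coeff-scale c p m)
  (trans (cong (c *_) (coeff-≗ p≋q m)) (sym (coeff-scale c q m)))

−ᴾ-cong : ∀ {p p′ q q′} → p ≋ p′ → q ≋ q′ → p −ᴾ q ≋ p′ −ᴾ q′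
−ᴾ-cong p≋p′ q≋q′ = +ᴾ-cong p≋p′ (scale-cong (- 1ℚ) q≋q′)

+ᴾ-identityʳ : ∀ p → p +ᴾ zeroP ≋ p
+ᴾ-identityʳ p = mk≋ λ m → trans (coeff-+ᴾ p zeroP m) (+-identityʳ (coeff p m))

−ᴾ-self : ∀ p → p −ᴾ p ≋ zeroP
−ᴾ-self p = mk≋ λ m → trans (coeff-−ᴾ p p m) (+-inverseʳ (coeff p m))

−ᴾ≋0⇒≋ : ∀ {p q} → p −ᴾ q ≋ zeroP → p ≋ q
−ᴾ≋0⇒≋ {p} {q} p−q≋0 = mk≋ λ m → begin
  coeff p m                        ≡⟨ x≡[x-y]+y (coeff p m) (coeff q m) ⟩
  (coeff p m - coeff q m) + coeff q m ≡⟨ cong (_+ coeff q m) (trans (sym (coeff-−ᴾ p q m)) (coeff-≗ p−q≋0 m)) ⟩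
  0ℚ + coeff q m                   ≡⟨ +-identityˡ (coeff q m) ⟩
  coeff q m                        ∎
  where
  open ≡-Reasoning
  x≡[x-y]+y : ∀ x y → x ≡ (x - y) + y
  x≡[x-y]+y = solve 2 (λ x y → x := (x :- y) :+ y) refl

+ᴾ-−ᴾ-cancel : ∀ p q → q +ᴾ (p −ᴾ q) ≋ p
+ᴾ-−ᴾ-cancel p q = mk≋ λ m → trans (coeff-+ᴾ q (p −ᴾ q) m)
  (trans (cong (coeff q m +_) (coeff-−ᴾ p q m)) (y+[x-y]≡x (coeff p m) (coeff q m)))
  where
  y+[x-y]≡x : ∀ x y → y + (x - y) ≡ x
  y+[x-y]≡x = solve 2 (λ x y → y :+ (x :- y) := x) refl

−ᴾ-+ᴾ-cancel : ∀ p q → (p −ᴾ q) +ᴾ q ≋ p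
−ᴾ-+ᴾ-cancel p q = mk≋ λ m → trans (coeff-+ᴾ (p −ᴾ q) q m)
  (trans (cong (_+ coeff q m) (coeff-−ᴾ p q m)) ([x-y]+y≡x (coeff p m) (coeff q m)))
  where
  [x-y]+y≡x : ∀ x y → (x - y) + y ≡ x
  [x-y]+y≡x = solve 2 (λ x y → (x :- y) :+ y := x) refl

−ᴾ-+ᴾ-interchange : ∀ a b c d → (a −ᴾ b) +ᴾ (c −ᴾ d) ≋ (a +ᴾ c) −ᴾ (b +ᴾ d)
−ᴾ-+ᴾ-interchange a b c d = mk≋ λ m → begin
  coeff ((a −ᴾ b) +ᴾ (c −ᴾ d)) m
    ≡⟨ trans (coeff-+ᴾ (a −ᴾ b) (c −ᴾ d) m) (cong₂ _+_ (coeff-−ᴾ a b m) (coeff-−ᴾ c d m)) ⟩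
  (coeff a m - coeff b m) + (coeff c m - coeff d m)
    ≡⟨ interchange (coeff a m) (coeff b m) (coeff c m) (coeff d m) ⟩
  (coeff a m + coeff c m) - (coeff b m + coeff d m)
    ≡⟨ trans (coeff-−ᴾ (a +ᴾ c) (b +ᴾ d) m) (cong₂ _-_ (coeff-+ᴾ a c m) (coeff-+ᴾ b d m)) ⟨
  coeff ((a +ᴾ c) −ᴾ (b +ᴾ d)) m ∎
  where
  open ≡-Reasoning
  interchange : ∀ a b c d → (a - b) + (c - d) ≡ (a + c) - (b + d)
  interchange = solve 4 (λ a b c d → (a :- b) :+ (c :- d) := (a :+ c) :- (b :+ d)) refl

+ᴾ-scale-merge : ∀ a c h d → (a +ᴾ scale h d) +ᴾ scale c d ≋ a +ᴾ scale (c + h) d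
+ᴾ-scale-merge a c h d = mk≋ λ m → begin
  coeff ((a +ᴾ scale h d) +ᴾ scale c d) m
    ≡⟨ trans (coeff-+ᴾ (a +ᴾ scale h d) (scale c d) m)
             (cong₂ _+_ (trans (coeff-+ᴾ a (scale h d) m) (cong (coeff a m +_) (coeff-scale h d m))) (coeff-scale c d m)) ⟩
  (coeff a m + h * coeff d m) + c * coeff d m
    ≡⟨ merge (coeff a m) c h (coeff d m) ⟩
  coeff a m + (c + h) * coeff d m
    ≡⟨ trans (coeff-+ᴾ a (scale (c + h) d) m) (cong (coeff a m +_) (coeff-scale (c + h) d m)) ⟨
  coeff (a +ᴾ scale (c + h) d) m ∎
  where
  open ≡-Reasoning
  merge : ∀ a c h d → (a + h * d) + c * d ≡ a + (c + h) * d
  merge = solve 4 (λ a c h d → (a :+ h :* d) :+ c :* d := a :+ (c :+ h) :* d) refl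

+ᴾ-scale-difference : ∀ a c h d → (a +ᴾ scale (c + h) d) −ᴾ (a +ᴾ scale h d) ≋ scale c d
+ᴾ-scale-difference a c h d = mk≋ λ m → begin
  coeff ((a +ᴾ scale (c + h) d) −ᴾ (a +ᴾ scale h d)) m
    ≡⟨ trans (coeff-−ᴾ (a +ᴾ scale (c + h) d) (a +ᴾ scale h d) m) (cong₂ _-_
         (trans (coeff-+ᴾ a (scale (c + h) d) m) (cong (coeff a m +_) (coeff-scale (c + h) d m)))
         (trans (coeff-+ᴾ a (scale h d) m) (cong (coeff a m +_) (coeff-scale h d m)))) ⟩
  (coeff a m + (c + h) * coeff d m) - (coeff a m + h * coeff d m)
    ≡⟨ difference (coeff a m) c h (coeff d m) ⟩
  c * coeff d m
    ≡⟨ coeff-scale c d m ⟨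
  coeff (scale c d) m ∎
  where
  open ≡-Reasoning
  difference : ∀ a c h d → (a + (c + h) * d) - (a + h * d) ≡ c * d
  difference = solve 4 (λ a c h d → (a :+ (c :+ h) :* d) :- (a :+ h :* d) := c :* d) refl

scale-inverseʳ : ∀ c (c≢0 : c ≢ 0ℚ) p → scale c (scale (inverse c c≢0) p) ≋ p
scale-inverseʳ c c≢0 p = mk≋ λ m → begin
  coeff (scale c (scale c⁻¹ p)) m   ≡⟨ trans (coeff-scale c (scale c⁻¹ p) m) (cong (c *_) (coeff-scale c⁻¹ p m)) ⟩
  c * (c⁻¹ * coeff p m)             ≡⟨ sym (*-assoc c c⁻¹ (coeff p m)) ⟩
  c * c⁻¹ * coeff p m               ≡⟨ cong (_* coeff p m) (trans (*-comm c c⁻¹) (inverse-*ˡ c c≢0)) ⟩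
  1ℚ * coeff p m                    ≡⟨ *-identityˡ (coeff p m) ⟩
  coeff p m                         ∎
  where
  open ≡-Reasoning
  c⁻¹ = inverse c c≢0

scale-inverseˡ : ∀ c (c≢0 : c ≢ 0ℚ) p → scale (inverse c c≢0) (scale c p) ≋ p
scale-inverseˡ c c≢0 p = mk≋ λ m → begin
  coeff (scale c⁻¹ (scale c p)) m   ≡⟨ trans (coeff-scale c⁻¹ (scale c p) m) (cong (c⁻¹ *_) (coeff-scale c p m)) ⟩
  c⁻¹ * (c * coeff p m)             ≡⟨ sym (*-assoc c⁻¹ c (coeff p m)) ⟩
  c⁻¹ * c * coeff p m               ≡⟨ cong (_* coeff p m) (inverse-*ˡ c c≢0) ⟩
  1ℚ * coeff p m                    ≡⟨ *-identityˡ (coeff p m) ⟩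
  coeff p m                         ∎
  where
  open ≡-Reasoning
  c⁻¹ = inverse c c≢0

scale-cancel : ∀ c → c ≢ 0ℚ → ∀ {p} → scale c p ≋ zeroP → p ≋ zeroP
scale-cancel c c≢0 {p} cp≋0 = mk≋ λ m → begin
  coeff p m                   ≡⟨ *-identityˡ (coeff p m) ⟨
  1ℚ * coeff p m              ≡⟨ cong (_* coeff p m) (inverse-*ˡ c c≢0) ⟨
  c⁻¹ * c * coeff p m         ≡⟨ *-assoc c⁻¹ c (coeff p m) ⟩
  c⁻¹ * (c * coeff p m)       ≡⟨ cong (c⁻¹ *_) (trans (sym (coeff-scale c p m)) (coeff-≗ cp≋0 m)) ⟩
  c⁻¹ * 0ℚ                    ≡⟨ *-zeroʳ c⁻¹ ⟩
  0ℚ                          ∎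
  where
  open ≡-Reasoning
  c⁻¹ = inverse c c≢0

Q₂ : Poly → Poly
Q₂ p = Q 2 *ᴾ p

coeff-Q₂ : ∀ p m → coeff (Q₂ p) m ≡ mulQ 2 (coeff p) m
coeff-Q₂ = coeff-Q*ᴾ 2

Q₂-cong : ∀ {p q} → p ≋ q → Q₂ p ≋ Q₂ q
Q₂-cong {p} {q} p≋q = mk≋ λ m → trans (coeff-Q₂ p m)
  (trans (≗-cong (mulQ-linear 2) (coeff-≗ p≋q) m) (sym (coeff-Q₂ q m)))

Q₂-−ᴾ : ∀ p q → Q₂ (p −ᴾ q) ≋ Q₂ p −ᴾ Q₂ q
Q₂-−ᴾ p q = mk≋ λ m → begin
  coeff (Q₂ (p −ᴾ q)) m                       ≡⟨ coeff-Q₂ (p −ᴾ q) m ⟩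
  mulQ 2 (coeff (p −ᴾ q)) m                   ≡⟨ ≗-cong (mulQ-linear 2) (coeff-−ᴾ p q) m ⟩
  whenPos (exponent m 1) (coeff p (lower 1 m) - coeff q (lower 1 m))
                                              ≡⟨ whenPos-− (exponent m 1) _ _ ⟩
  mulQ 2 (coeff p) m - mulQ 2 (coeff q) m     ≡⟨ cong₂ _-_ (coeff-Q₂ p m) (coeff-Q₂ q m) ⟨
  coeff (Q₂ p) m - coeff (Q₂ q) m             ≡⟨ coeff-−ᴾ (Q₂ p) (Q₂ q) m ⟨
  coeff (Q₂ p −ᴾ Q₂ q) m                      ∎
  where
  open ≡-Reasoning
  whenPos-− : ∀ e x y → whenPos e (x - y) ≡ whenPos e x - whenPos e y
  whenPos-− zero x y = refl
  whenPos-− (suc _) x y = refl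

-- Δ modulo Q₁. Opaque, because unfolding it during conversion checking is prohibitively expensive.
opaque
  Δ̄ : Poly → Poly
  Δ̄ p = withoutQ₁ (Δ p)

  Δ̄-unfold : ∀ p → Δ̄ p ≡ withoutQ₁ (Δ p)
  Δ̄-unfold p = refl

coeff-Δ̄-Δ : ∀ p m → coeff (Δ̄ p) m ≡ whenZero (exponent m 0) (coeff (Δ p) m)
coeff-Δ̄-Δ p m = trans (cong (λ q → coeff q m) (Δ̄-unfold p)) (coeff-withoutQ₁ (Δ p) m)

coeff-Δ̄ : ∀ {M} p → cutoff p ≤ M → ∀ m → coeff (Δ̄ p) m ≡ whenZero (exponent m 0) (Δᶜ M (coeff p) m)
coeff-Δ̄ p cut≤M m = trans (coeff-Δ̄-Δ p m) (cong (whenZero (exponent m 0)) (coeff-Δ p cut≤M m))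

Δ̄-cong : ∀ {p q} → p ≋ q → Δ̄ p ≋ Δ̄ q
Δ̄-cong {p} {q} p≋q = mk≋ λ m → begin
  coeff (Δ̄ p) m                                   ≡⟨ coeff-Δ̄ p (ℕ.m≤m⊔n (cutoff p) (cutoff q)) m ⟩
  whenZero (exponent m 0) (Δᶜ M (coeff p) m)      ≡⟨ cong (whenZero (exponent m 0)) (≗-cong (Δᶜ-linear M) (coeff-≗ p≋q) m) ⟩
  whenZero (exponent m 0) (Δᶜ M (coeff q) m)      ≡⟨ coeff-Δ̄ q (ℕ.m≤n⊔m (cutoff p) (cutoff q)) m ⟨
  coeff (Δ̄ q) m                                   ∎
  where
  open ≡-Reasoning
  M = cutoff p ⊔ cutoff q

Δ̄-+ᴾ : ∀ p q → Δ̄ (p +ᴾ q) ≋ Δ̄ p +ᴾ Δ̄ q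
Δ̄-+ᴾ p q = mk≋ λ m → begin
  coeff (Δ̄ (p +ᴾ q)) m
    ≡⟨ coeff-Δ̄ (p +ᴾ q) (ℕ.m≤m⊔n (cutoff (p +ᴾ q)) _) m ⟩
  whenZero (exponent m 0) (Δᶜ M (coeff (p +ᴾ q)) m)
    ≡⟨ cong (whenZero (exponent m 0)) (trans (≗-cong (Δᶜ-linear M) (coeff-+ᴾ p q) m) (additive (Δᶜ-linear M) (coeff p) (coeff q) m)) ⟩
  whenZero (exponent m 0) (Δᶜ M (coeff p) m + Δᶜ M (coeff q) m)
    ≡⟨ whenZero-+ (exponent m 0) _ _ ⟩
  whenZero (exponent m 0) (Δᶜ M (coeff p) m) + whenZero (exponent m 0) (Δᶜ M (coeff q) m)
    ≡⟨ cong₂ _+_ (coeff-Δ̄ p (ℕ.≤-trans (ℕ.m≤m⊔n (cutoff p) (cutoff q)) (ℕ.m≤n⊔m (cutoff (p +ᴾ q)) _)) m)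
                 (coeff-Δ̄ q (ℕ.≤-trans (ℕ.m≤n⊔m (cutoff p) (cutoff q)) (ℕ.m≤n⊔m (cutoff (p +ᴾ q)) _)) m) ⟨
  coeff (Δ̄ p) m + coeff (Δ̄ q) m
    ≡⟨ coeff-+ᴾ (Δ̄ p) (Δ̄ q) m ⟨
  coeff (Δ̄ p +ᴾ Δ̄ q) m ∎
  where
  open ≡-Reasoning
  M = cutoff (p +ᴾ q) ⊔ (cutoff p ⊔ cutoff q)

Δ̄-scale : ∀ c p → Δ̄ (scale c p) ≋ scale c (Δ̄ p)
Δ̄-scale c p = mk≋ λ m → begin
  coeff (Δ̄ (scale c p)) m
    ≡⟨ coeff-Δ̄ (scale c p) (ℕ.m≤m⊔n (cutoff (scale c p)) (cutoff p)) m ⟩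
  whenZero (exponent m 0) (Δᶜ M (coeff (scale c p)) m)
    ≡⟨ cong (whenZero (exponent m 0)) (trans (≗-cong (Δᶜ-linear M) (coeff-scale c p) m) (homogeneous (Δᶜ-linear M) c (coeff p) m)) ⟩
  whenZero (exponent m 0) (c * Δᶜ M (coeff p) m)
    ≡⟨ whenZero-* (exponent m 0) c _ ⟩
  c * whenZero (exponent m 0) (Δᶜ M (coeff p) m)
    ≡⟨ cong (c *_) (coeff-Δ̄ p (ℕ.m≤n⊔m (cutoff (scale c p)) (cutoff p)) m) ⟨
  c * coeff (Δ̄ p) m
    ≡⟨ coeff-scale c (Δ̄ p) m ⟨
  coeff (scale c (Δ̄ p)) m ∎
  where
  open ≡-Reasoning
  M = cutoff (scale c p) ⊔ cutoff p

Δ̄-−ᴾ : ∀ p q → Δ̄ (p −ᴾ q) ≋ Δ̄ p −ᴾ Δ̄ q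
Δ̄-−ᴾ p q = ≋-trans (Δ̄-+ᴾ p (-ᴾ q)) (+ᴾ-cong ≋-refl (Δ̄-scale (- 1ℚ) q))

InΛ-coeff : ∀ p → InΛ p → ∀ m → 0 < exponent m 0 → coeff p m ≡ 0ℚ
InΛ-coeff p pΛ (suc e ∷ m) _ = pΛ e m

exponent₀-lower₁ : ∀ m → exponent (lower 1 m) 0 ≡ exponent m 0
exponent₀-lower₁ m = exponent-lower-other 1 m λ ()

InΛw-zero : ∀ n → InΛw n zeroP
InΛw-zero n = (λ _ _ → refl) , (λ _ _ → refl)

InΛw-+ᴾ : ∀ n p q → InΛw n p → InΛw n q → InΛw n (p +ᴾ q)
InΛw-+ᴾ n p q (pΛ , p-hom) (qΛ , q-hom) =
  (λ e m → trans (coeff-+ᴾ p q (suc e ∷ m)) (trans (cong₂ _+_ (pΛ e m) (qΛ e m)) (+-identityˡ 0ℚ))) ,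
  (λ m w≢n → trans (coeff-+ᴾ p q m) (trans (cong₂ _+_ (p-hom m w≢n) (q-hom m w≢n)) (+-identityˡ 0ℚ)))

InΛw-scale : ∀ n c p → InΛw n p → InΛw n (scale c p)
InΛw-scale n c p (pΛ , hom) =
  (λ e m → trans (coeff-scale c p (suc e ∷ m)) (trans (cong (c *_) (pΛ e m)) (*-zeroʳ c))) ,
  (λ m w≢n → trans (coeff-scale c p m) (trans (cong (c *_) (hom m w≢n)) (*-zeroʳ c)))

InΛw-−ᴾ : ∀ n p q → InΛw n p → InΛw n q → InΛw n (p −ᴾ q)
InΛw-−ᴾ n p q pΛw qΛw = InΛw-+ᴾ n p (-ᴾ q) pΛw (InΛw-scale n (- 1ℚ) q qΛw)

InΛw-Q₂ : ∀ n p → InΛw n p → InΛw (2 ℕ.+ n) (Q₂ p)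
InΛw-Q₂ n p (pΛ , hom) = Q₂pΛ , Q₂p-hom
  where
  Q₂pΛ : InΛ (Q₂ p)
  Q₂pΛ e r = trans (coeff-Q₂ p m) (trans (cong (whenPos (exponent m 1))
    (InΛ-coeff p pΛ (lower 1 m) (subst (0 <_) (sym (exponent₀-lower₁ m)) (s≤s z≤n)))) (whenPos-0 (exponent m 1)))
    where m = suc e ∷ r
  Q₂p-hom : Homog (2 ℕ.+ n) (Q₂ p)
  Q₂p-hom m w≢2+n = trans (coeff-Q₂ p m)
    (subst (λ b → HomogeneousOf b (mulQ 2 (coeff p))) (ℕ.+-comm n 2) (shifted-mulQ 0 n 2 hom) m w≢2+n)

InΛw-Δ̄ : ∀ n p → InΛw (2 ℕ.+ n) p → InΛw n (Δ̄ p)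
InΛw-Δ̄ n p (_ , hom) = (λ e m → coeff-Δ̄-Δ p (suc e ∷ m)) , Δ̄p-hom
  where
  Δᶜp-hom : HomogeneousOf n (Δᶜ (cutoff p) (coeff p))
  Δᶜp-hom = shifted-cancel 0 n 2 (subst (λ b → ShiftedHomogeneous 2 b (Δᶜ (cutoff p) (coeff p))) (ℕ.+-comm 2 n) (shifted-Δᶜ 0 (2 ℕ.+ n) (cutoff p) hom))
  Δ̄p-hom : Homog n (Δ̄ p)
  Δ̄p-hom m w≢n = trans (coeff-Δ̄ p ℕ.≤-refl m) (trans (cong (whenZero (exponent m 0)) (Δᶜp-hom m w≢n)) (whenZero-0 (exponent m 0)))

Δ̄-vanishes-below-2 : ∀ n p → n < 2 → InΛw n p → Δ̄ p ≋ zeroP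
Δ̄-vanishes-below-2 n p n<2 (_ , hom) = mk≋ λ m → trans (coeff-Δ̄ p ℕ.≤-refl m)
  (trans (cong (whenZero (exponent m 0)) (shifted-Δᶜ 0 n (cutoff p) hom m λ 2+w≡n → ℕ.<⇒≱ n<2 (subst (2 ≤_) 2+w≡n (ℕ.m≤m+n 2 (weight m)))))
         (whenZero-0 (exponent m 0)))

-- Reduction modulo Q₁ commutes with Q₂, kills multiples of Q₁ and fixes coefficients free of Q₁.
whenZero-commutator : ∀ (A B X : Coeffs) h → (∀ m → 0 < exponent m 0 → X m ≡ 0ℚ) → ∀ m →
  whenZero (exponent m 0) (mulQ 2 A m + h * X m - mulQ 1 B m) ≡ mulQ 2 (λ m′ → whenZero (exponent m′ 0) (A m′)) m + h * X m
whenZero-commutator A B X h X-free m = by-exponent₀ (exponent m 0) refl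
  where
  by-exponent₀ : ∀ e → exponent m 0 ≡ e →
    whenZero e (mulQ 2 A m + h * X m - mulQ 1 B m) ≡ mulQ 2 (λ m′ → whenZero (exponent m′ 0) (A m′)) m + h * X m
  by-exponent₀ zero e rewrite exponent₀-lower₁ m | e = +-identityʳ (mulQ 2 A m + h * X m)
  by-exponent₀ (suc _) e rewrite exponent₀-lower₁ m | e | X-free m (subst (0 <_) (sym e) (s≤s z≤n)) =
    sym (trans (cong₂ _+_ (whenPos-0 (exponent m 1)) (*-zeroʳ h)) (+-identityʳ 0ℚ))

Δ̄-Q₂ : ∀ w x → InΛw w x → Δ̄ (Q₂ x) ≋ Q₂ (Δ̄ x) +ᴾ scale (ℕtoℚ w - ½) x
Δ̄-Q₂ w x (xΛ , hom) = mk≋ λ m → begin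
  coeff (Δ̄ (Q₂ x)) m
    ≡⟨ coeff-Δ̄ (Q₂ x) (ℕ.m≤m⊔n (cutoff (Q₂ x)) (cutoff x ⊔ 2)) m ⟩
  whenZero (exponent m 0) (Δᶜ M (coeff (Q₂ x)) m)
    ≡⟨ cong (whenZero (exponent m 0)) (trans (≗-cong (Δᶜ-linear M) (coeff-Q₂ x) m)
                                             (Δᶜ-mulQ₂ w M (coeff-cong x) supported 2≤M hom m)) ⟩
  whenZero (exponent m 0) (mulQ 2 (Δᶜ M X) m + h * X m - mulQ 1 (bdᶜ M X) m)
    ≡⟨ whenZero-commutator (Δᶜ M X) (bdᶜ M X) X h (InΛ-coeff x xΛ) m ⟩
  mulQ 2 (λ m′ → whenZero (exponent m′ 0) (Δᶜ M X m′)) m + h * X m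
    ≡⟨ cong₂ _+_ (trans (coeff-Q₂ (Δ̄ x) m) (≗-cong (mulQ-linear 2) (coeff-Δ̄ x x-cut≤M) m)) (coeff-scale h x m) ⟨
  coeff (Q₂ (Δ̄ x)) m + coeff (scale h x) m
    ≡⟨ coeff-+ᴾ (Q₂ (Δ̄ x)) (scale h x) m ⟨
  coeff (Q₂ (Δ̄ x) +ᴾ scale h x) m ∎
  where
  open ≡-Reasoning
  X = coeff x
  h = ℕtoℚ w - ½
  M = cutoff (Q₂ x) ⊔ (cutoff x ⊔ 2)
  x-cut≤M : cutoff x ≤ M
  x-cut≤M = ℕ.≤-trans (ℕ.m≤m⊔n (cutoff x) 2) (ℕ.m≤n⊔m (cutoff (Q₂ x)) (cutoff x ⊔ 2))
  2≤M : 2 ≤ M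
  2≤M = ℕ.≤-trans (ℕ.m≤n⊔m (cutoff x) 2) (ℕ.m≤n⊔m (cutoff (Q₂ x)) (cutoff x ⊔ 2))
  supported : Supported M X
  supported = Supported-mono (ℕ.≤-trans (ℕ.m≤m⊔n (maxLen x) (maxLen (bd x))) x-cut≤M) (coeff-supported x)

InH⇒Δ̄≋0 : ∀ n p → InH n p → Δ̄ p ≋ zeroP
InH⇒Δ̄≋0 n p (_ , g , Δp≈Q₁g) = mk≋ λ m → begin
  coeff (Δ̄ p) m                                   ≡⟨ coeff-Δ̄-Δ p m ⟩
  whenZero (exponent m 0) (coeff (Δ p) m)          ≡⟨ cong (whenZero (exponent m 0)) (trans (Δp≈Q₁g m) (coeff-Q*ᴾ 1 g m)) ⟩
  whenZero (exponent m 0) (mulQ 1 (coeff g) m)     ≡⟨ annihilate (exponent m 0) ⟩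
  0ℚ                                               ∎
  where
  open ≡-Reasoning
  annihilate : ∀ e {x} → whenZero e (whenPos e x) ≡ 0ℚ
  annihilate zero = refl
  annihilate (suc _) = refl

Δ̄≋0⇒InH : ∀ n p → InΛw n p → Δ̄ p ≋ zeroP → InH n p
Δ̄≋0⇒InH n p pΛw Δ̄p≋0 = pΛw , divQ₁ (Δ p) , λ m → begin
  coeff (Δ p) m                                            ≡⟨ x≡[x-y]+y (coeff (Δ p) m) (coeff (Q₁÷Q₁ (Δ p)) m) ⟩
  (coeff (Δ p) m - coeff (Q₁÷Q₁ (Δ p)) m) + coeff (Q₁÷Q₁ (Δ p)) m
                                                           ≡⟨ cong (_+ coeff (Q₁÷Q₁ (Δ p)) m) (sym (trans (cong (λ q → coeff q m) (Δ̄-unfold p)) (coeff-−ᴾ (Δ p) (Q₁÷Q₁ (Δ p)) m))) ⟩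
  coeff (Δ̄ p) m + coeff (Q₁÷Q₁ (Δ p)) m                     ≡⟨ cong (_+ coeff (Q₁÷Q₁ (Δ p)) m) (coeff-≗ Δ̄p≋0 m) ⟩
  0ℚ + coeff (Q₁÷Q₁ (Δ p)) m                                ≡⟨ +-identityˡ _ ⟩
  coeff (Q₁÷Q₁ (Δ p)) m                                     ∎
  where
  open ≡-Reasoning
  Q₁÷Q₁ : Poly → Poly
  Q₁÷Q₁ q = Q 1 *ᴾ divQ₁ q
  x≡[x-y]+y : ∀ x y → x ≡ (x - y) + y
  x≡[x-y]+y = solve 2 (λ x y → x := (x :- y) :+ y) refl

-- Inverting Q₂ Δ̄ + τ

-- Θ m k = Q₂Δ̄ + τ m k: the coefficients τ are chosen so that Δ̄ ∘ Θ (2 + m) k = Θ m (1 + k) ∘ Δ̄.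
τ : ℕ → ℕ → ℚ
τ m k = ℕtoℚ (suc k) * (ℕtoℚ (m ℕ.+ k) - ½)

τ≢0 : ∀ m k → τ m k ≢ 0ℚ
τ≢0 m k = *-≢0 (ℕtoℚ-suc≢0 k) (ℕtoℚ-½≢0 (m ℕ.+ k))

τ-zero : ∀ m → τ m 0 ≡ ℕtoℚ m - ½
τ-zero m = trans (*-identityˡ (ℕtoℚ (m ℕ.+ 0) - ½)) (cong (λ j → ℕtoℚ j - ½) (ℕ.+-identityʳ m))

τ-suc : ∀ m k → τ m (suc k) ≡ τ (2 ℕ.+ m) k + (ℕtoℚ m - ½)
τ-suc m k = begin
  ℕtoℚ (2 ℕ.+ k) * (ℕtoℚ (m ℕ.+ suc k) - ½)
    ≡⟨ cong₂ (λ a b → a * (b - ½)) (ℕtoℚ-+ 2 k)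
             (trans (cong ℕtoℚ (ℕ.+-suc m k)) (trans (ℕtoℚ-+ 1 (m ℕ.+ k)) (cong (1ℚ +_) (ℕtoℚ-+ m k)))) ⟩
  (ℕtoℚ 2 + ℕtoℚ k) * (1ℚ + (ℕtoℚ m + ℕtoℚ k) - ½)
    ≡⟨ expand (ℕtoℚ m) (ℕtoℚ k) ⟩
  (1ℚ + ℕtoℚ k) * (ℕtoℚ 2 + (ℕtoℚ m + ℕtoℚ k) - ½) + (ℕtoℚ m - ½)
    ≡⟨ cong₂ (λ a b → a * (b - ½) + (ℕtoℚ m - ½)) (ℕtoℚ-+ 1 k) (trans (ℕtoℚ-+ 2 (m ℕ.+ k)) (cong (ℕtoℚ 2 +_) (ℕtoℚ-+ m k))) ⟨
  τ (2 ℕ.+ m) k + (ℕtoℚ m - ½) ∎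
  where
  open ≡-Reasoning
  expand : ∀ M K → (ℕtoℚ 2 + K) * (1ℚ + (M + K) - ½) ≡ (1ℚ + K) * (ℕtoℚ 2 + (M + K) - ½) + (M - ½)
  expand = solve 2 (λ M K → (con (ℕtoℚ 2) :+ K) :* (con 1ℚ :+ (M :+ K) :- con ½)
                          := (con 1ℚ :+ K) :* (con (ℕtoℚ 2) :+ (M :+ K) :- con ½) :+ (M :- con ½)) refl

Θ : ℕ → ℕ → Poly → Poly
Θ m k x = Q₂ (Δ̄ x) +ᴾ scale (τ m k) x

Θ-Preimage : ℕ → ℕ → Poly → Set
Θ-Preimage m k y = Σ Poly λ x → InΛw m x × Θ m k x ≋ y

Δ̄-Θ : ∀ m k x → InΛw (2 ℕ.+ m) x → Δ̄ (Θ (2 ℕ.+ m) k x) ≋ Θ m (suc k) (Δ̄ x)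
Δ̄-Θ m k x xΛw = begin
  Δ̄ (Q₂ (Δ̄ x) +ᴾ scale (τ (2 ℕ.+ m) k) x)                       ≈⟨ Δ̄-+ᴾ (Q₂ (Δ̄ x)) (scale (τ (2 ℕ.+ m) k) x) ⟩
  Δ̄ (Q₂ (Δ̄ x)) +ᴾ Δ̄ (scale (τ (2 ℕ.+ m) k) x)                   ≈⟨ +ᴾ-cong (Δ̄-Q₂ m (Δ̄ x) (InΛw-Δ̄ m x xΛw)) (Δ̄-scale (τ (2 ℕ.+ m) k) x) ⟩
  (Q₂ (Δ̄ (Δ̄ x)) +ᴾ scale (ℕtoℚ m - ½) (Δ̄ x)) +ᴾ scale (τ (2 ℕ.+ m) k) (Δ̄ x)
                                                                  ≈⟨ +ᴾ-scale-merge (Q₂ (Δ̄ (Δ̄ x))) (τ (2 ℕ.+ m) k) (ℕtoℚ m - ½) (Δ̄ x) ⟩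
  Q₂ (Δ̄ (Δ̄ x)) +ᴾ scale (τ (2 ℕ.+ m) k + (ℕtoℚ m - ½)) (Δ̄ x)    ≡⟨ cong (λ c → Q₂ (Δ̄ (Δ̄ x)) +ᴾ scale c (Δ̄ x)) (τ-suc m k) ⟨
  Θ m (suc k) (Δ̄ x)                                               ∎
  where open ≋-Reasoning

Θ-harmonic : ∀ m k {x} → Δ̄ x ≋ zeroP → Θ m k x ≋ scale (τ m k) x
Θ-harmonic m k Δ̄x≋0 = +ᴾ-cong (Q₂-cong Δ̄x≋0) ≋-refl

Θ-injective : ∀ m k x → InΛw m x → Θ m k x ≋ zeroP → x ≋ zeroP
Θ-injective m k x xΛw Θx≋0 = scale-cancel (τ m k) (τ≢0 m k) (≋-trans (≋-sym (Θ-harmonic m k (Δ̄x≋0 m x xΛw Θx≋0))) Θx≋0)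
  where
  Δ̄x≋0 : ∀ m x → InΛw m x → Θ m k x ≋ zeroP → Δ̄ x ≋ zeroP
  Δ̄x≋0 zero x xΛw _ = Δ̄-vanishes-below-2 0 x (s≤s z≤n) xΛw
  Δ̄x≋0 (suc zero) x xΛw _ = Δ̄-vanishes-below-2 1 x (s≤s (s≤s z≤n)) xΛw
  Δ̄x≋0 (suc (suc m)) x xΛw Θx≋0 = Θ-injective m (suc k) (Δ̄ x) (InΛw-Δ̄ m x xΛw)
    (≋-trans (≋-sym (Δ̄-Θ m k x xΛw)) (≋-trans (Δ̄-cong Θx≋0) (Δ̄-vanishes-below-2 0 zeroP (s≤s z≤n) (InΛw-zero 0))))

Θ-surjective-below-2 : ∀ n k y → n < 2 → InΛw n y → Θ-Preimage n k y
Θ-surjective-below-2 n k y n<2 yΛw = x , xΛw ,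
  ≋-trans (Θ-harmonic n k (Δ̄-vanishes-below-2 n x n<2 xΛw)) (scale-inverseʳ (τ n k) (τ≢0 n k) y)
  where
  x = scale (inverse (τ n k) (τ≢0 n k)) y
  xΛw = InΛw-scale n (inverse (τ n k) (τ≢0 n k)) y yΛw

Θ-preimage-lift : ∀ m k y → InΛw (2 ℕ.+ m) y → Θ-Preimage m (suc k) (Δ̄ y) → Θ-Preimage (2 ℕ.+ m) k y
Θ-preimage-lift m k y yΛw (z , zΛw , Θz≋Δ̄y) = x , xΛw , Θx≋y
  where
  c = τ (2 ℕ.+ m) k
  c⁻¹ = inverse c (τ≢0 (2 ℕ.+ m) k)
  h = ℕtoℚ m - ½
  x = scale c⁻¹ (y −ᴾ Q₂ z)
  xΛw : InΛw (2 ℕ.+ m) x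
  xΛw = InΛw-scale (2 ℕ.+ m) c⁻¹ (y −ᴾ Q₂ z) (InΛw-−ᴾ (2 ℕ.+ m) y (Q₂ z) yΛw (InΛw-Q₂ m z zΛw))
  Δ̄x≋z : Δ̄ x ≋ z
  Δ̄x≋z = begin
    Δ̄ (scale c⁻¹ (y −ᴾ Q₂ z))                                  ≈⟨ ≋-trans (Δ̄-scale c⁻¹ (y −ᴾ Q₂ z)) (scale-cong c⁻¹ (Δ̄-−ᴾ y (Q₂ z))) ⟩
    scale c⁻¹ (Δ̄ y −ᴾ Δ̄ (Q₂ z))                                ≈⟨ scale-cong c⁻¹ (−ᴾ-cong (≋-sym Θz≋Δ̄y) (Δ̄-Q₂ m z zΛw)) ⟩
    scale c⁻¹ (Θ m (suc k) z −ᴾ (Q₂ (Δ̄ z) +ᴾ scale h z))        ≡⟨ cong (λ a → scale c⁻¹ ((Q₂ (Δ̄ z) +ᴾ scale a z) −ᴾ (Q₂ (Δ̄ z) +ᴾ scale h z))) (τ-suc m k) ⟩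
    scale c⁻¹ ((Q₂ (Δ̄ z) +ᴾ scale (c + h) z) −ᴾ (Q₂ (Δ̄ z) +ᴾ scale h z))
                                                                ≈⟨ scale-cong c⁻¹ (+ᴾ-scale-difference (Q₂ (Δ̄ z)) c h z) ⟩
    scale c⁻¹ (scale c z)                                       ≈⟨ scale-inverseˡ c (τ≢0 (2 ℕ.+ m) k) z ⟩
    z                                                           ∎
    where open ≋-Reasoning
  Θx≋y : Θ (2 ℕ.+ m) k x ≋ y
  Θx≋y = begin
    Q₂ (Δ̄ x) +ᴾ scale c (scale c⁻¹ (y −ᴾ Q₂ z))                 ≈⟨ +ᴾ-cong (Q₂-cong Δ̄x≋z) (scale-inverseʳ c (τ≢0 (2 ℕ.+ m) k) (y −ᴾ Q₂ z)) ⟩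
    Q₂ z +ᴾ (y −ᴾ Q₂ z)                                         ≈⟨ +ᴾ-−ᴾ-cancel y (Q₂ z) ⟩
    y                                                           ∎
    where open ≋-Reasoning

Θ-surjective : ∀ m k y → InΛw m y → Θ-Preimage m k y
Θ-surjective zero k y yΛw = Θ-surjective-below-2 zero k y (s≤s z≤n) yΛw
Θ-surjective (suc zero) k y yΛw = Θ-surjective-below-2 (suc zero) k y (s≤s (s≤s z≤n)) yΛw
Θ-surjective (suc (suc m)) k y yΛw = Θ-preimage-lift m k y yΛw (Θ-surjective m (suc k) (Δ̄ y) (InΛw-Δ̄ m y yΛw))

-- The harmonic decomposition

HarmonicSplit : ℕ → Poly → Set
HarmonicSplit n f = Σ Poly λ x → InΛw n x × Σ Poly λ h → InH (2 ℕ.+ n) h × f ≋ h +ᴾ Q₂ x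

harmonic-split : ∀ n f → InΛw (2 ℕ.+ n) f → HarmonicSplit n f
harmonic-split n f fΛw = lift (Θ-surjective n 0 (Δ̄ f) (InΛw-Δ̄ n f fΛw))
  where
  lift : Θ-Preimage n 0 (Δ̄ f) → HarmonicSplit n f
  lift (x , xΛw , Θx≋Δ̄f) = x , xΛw , f −ᴾ Q₂ x , hH , ≋-sym (−ᴾ-+ᴾ-cancel f (Q₂ x))
    where
    hΛw = InΛw-−ᴾ (2 ℕ.+ n) f (Q₂ x) fΛw (InΛw-Q₂ n x xΛw)
    Δ̄h≋0 : Δ̄ (f −ᴾ Q₂ x) ≋ zeroP
    Δ̄h≋0 = begin
      Δ̄ (f −ᴾ Q₂ x)                                       ≈⟨ Δ̄-−ᴾ f (Q₂ x) ⟩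
      Δ̄ f −ᴾ Δ̄ (Q₂ x)                                     ≈⟨ −ᴾ-cong (≋-sym Θx≋Δ̄f) (Δ̄-Q₂ n x xΛw) ⟩
      Θ n 0 x −ᴾ (Q₂ (Δ̄ x) +ᴾ scale (ℕtoℚ n - ½) x)      ≡⟨ cong (λ c → (Q₂ (Δ̄ x) +ᴾ scale c x) −ᴾ (Q₂ (Δ̄ x) +ᴾ scale (ℕtoℚ n - ½) x)) (τ-zero n) ⟩
      (Q₂ (Δ̄ x) +ᴾ scale (ℕtoℚ n - ½) x) −ᴾ (Q₂ (Δ̄ x) +ᴾ scale (ℕtoℚ n - ½) x)
                                                          ≈⟨ −ᴾ-self (Q₂ (Δ̄ x) +ᴾ scale (ℕtoℚ n - ½) x) ⟩
      zeroP                                               ∎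
      where open ≋-Reasoning
    hH = Δ̄≋0⇒InH (2 ℕ.+ n) (f −ᴾ Q₂ x) hΛw Δ̄h≋0

harmonic-split-kernel : ∀ n h x → InH (2 ℕ.+ n) h → InΛw n x → h +ᴾ Q₂ x ≋ zeroP → x ≋ zeroP
harmonic-split-kernel n h x hH xΛw h+Q₂x≋0 = Θ-injective n 0 x xΛw (begin
  Q₂ (Δ̄ x) +ᴾ scale (τ n 0) x              ≡⟨ cong (λ c → Q₂ (Δ̄ x) +ᴾ scale c x) (τ-zero n) ⟩
  Q₂ (Δ̄ x) +ᴾ scale (ℕtoℚ n - ½) x         ≈⟨ Δ̄-Q₂ n x xΛw ⟨
  Δ̄ (Q₂ x)                                 ≈⟨ +ᴾ-cong (InH⇒Δ̄≋0 (2 ℕ.+ n) h hH) ≋-refl ⟨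
  Δ̄ h +ᴾ Δ̄ (Q₂ x)                          ≈⟨ Δ̄-+ᴾ h (Q₂ x) ⟨
  Δ̄ (h +ᴾ Q₂ x)                            ≈⟨ Δ̄-cong h+Q₂x≋0 ⟩
  Δ̄ zeroP                                  ≈⟨ Δ̄-vanishes-below-2 0 zeroP (s≤s z≤n) (InΛw-zero 0) ⟩
  zeroP                                    ∎)
  where open ≋-Reasoning

harmonic-split-unique : ∀ n h h′ x x′ → InH (2 ℕ.+ n) h → InH (2 ℕ.+ n) h′ → InΛw n x → InΛw n x′ →
  h +ᴾ Q₂ x ≋ h′ +ᴾ Q₂ x′ → h ≋ h′ × x ≋ x′
harmonic-split-unique n h h′ x x′ hH h′H xΛw x′Λw eq = −ᴾ≋0⇒≋ h−h′≋0 , −ᴾ≋0⇒≋ x−x′≋0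
  where
  open ≋-Reasoning
  h−h′H : InH (2 ℕ.+ n) (h −ᴾ h′)
  h−h′H = Δ̄≋0⇒InH (2 ℕ.+ n) (h −ᴾ h′) (InΛw-−ᴾ (2 ℕ.+ n) h h′ (proj₁ hH) (proj₁ h′H)) (begin
    Δ̄ (h −ᴾ h′)       ≈⟨ Δ̄-−ᴾ h h′ ⟩
    Δ̄ h −ᴾ Δ̄ h′       ≈⟨ −ᴾ-cong (InH⇒Δ̄≋0 (2 ℕ.+ n) h hH) (InH⇒Δ̄≋0 (2 ℕ.+ n) h′ h′H) ⟩
    zeroP −ᴾ zeroP     ≈⟨ −ᴾ-self zeroP ⟩
    zeroP              ∎)
  sum≋0 : (h −ᴾ h′) +ᴾ Q₂ (x −ᴾ x′) ≋ zeroP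
  sum≋0 = begin
    (h −ᴾ h′) +ᴾ Q₂ (x −ᴾ x′)              ≈⟨ +ᴾ-cong (≋-refl {h −ᴾ h′}) (Q₂-−ᴾ x x′) ⟩
    (h −ᴾ h′) +ᴾ (Q₂ x −ᴾ Q₂ x′)           ≈⟨ −ᴾ-+ᴾ-interchange h h′ (Q₂ x) (Q₂ x′) ⟩
    (h +ᴾ Q₂ x) −ᴾ (h′ +ᴾ Q₂ x′)           ≈⟨ −ᴾ-cong eq (≋-refl {h′ +ᴾ Q₂ x′}) ⟩
    (h′ +ᴾ Q₂ x′) −ᴾ (h′ +ᴾ Q₂ x′)          ≈⟨ −ᴾ-self (h′ +ᴾ Q₂ x′) ⟩
    zeroP                                   ∎
  x−x′≋0 : x −ᴾ x′ ≋ zeroP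
  x−x′≋0 = harmonic-split-kernel n (h −ᴾ h′) (x −ᴾ x′) h−h′H (InΛw-−ᴾ n x x′ xΛw x′Λw) sum≋0
  h−h′≋0 : h −ᴾ h′ ≋ zeroP
  h−h′≋0 = begin
    h −ᴾ h′                        ≈⟨ +ᴾ-identityʳ (h −ᴾ h′) ⟨
    (h −ᴾ h′) +ᴾ Q₂ zeroP          ≈⟨ +ᴾ-cong (≋-refl {h −ᴾ h′}) (Q₂-cong x−x′≋0) ⟨
    (h −ᴾ h′) +ᴾ Q₂ (x −ᴾ x′)      ≈⟨ sum≋0 ⟩
    zeroP                          ∎

UniqueHarmonicDecomposition : ℕ → ℕ → Poly → Set
UniqueHarmonicDecomposition n K f =
  Σ (Fin (suc K) → Poly) (λ h →
    (∀ i → InH (n ∸ 2 ℕ.* toℕ i) (h i)) ×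
    f ≈ decomp (suc K) h ×
    ((h′ : Fin (suc K) → Poly) →
      (∀ i → InH (n ∸ 2 ℕ.* toℕ i) (h′ i)) →
      f ≈ decomp (suc K) h′ →
      ∀ i → h i ≈ h′ i))

∸-2*suc : ∀ n i → 2 ℕ.+ n ∸ 2 ℕ.* suc i ≡ n ∸ 2 ℕ.* i
∸-2*suc n i = cong (2 ℕ.+ n ∸_) (ℕ.*-suc 2 i)

decomp-InΛw : ∀ n (h : Fin (suc ⌊ n /2⌋) → Poly) → (∀ i → InΛw (n ∸ 2 ℕ.* toℕ i) (h i)) → InΛw n (decomp (suc ⌊ n /2⌋) h)
decomp-InΛw zero h hΛw = InΛw-+ᴾ 0 (h zero) zeroP (hΛw zero) (InΛw-zero 0)
decomp-InΛw (suc zero) h hΛw = InΛw-+ᴾ 1 (h zero) zeroP (hΛw zero) (InΛw-zero 1)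
decomp-InΛw (suc (suc n)) h hΛw = InΛw-+ᴾ (2 ℕ.+ n) (h zero) (Q₂ tail) (hΛw zero) (InΛw-Q₂ n tail
  (decomp-InΛw n (λ i → h (suc i)) λ i → subst (λ w → InΛw w (h (suc i))) (∸-2*suc n (toℕ i)) (hΛw (suc i))))
  where tail = decomp (suc ⌊ n /2⌋) (λ i → h (suc i))

decomposition-below-2 : ∀ n f → n < 2 → InΛw n f → UniqueHarmonicDecomposition n 0 f
decomposition-below-2 n f n<2 fΛw =
  (λ _ → f) ,
  (λ { zero → Δ̄≋0⇒InH n f fΛw (Δ̄-vanishes-below-2 n f n<2 fΛw) }) ,
  coeff-≗ (≋-sym (+ᴾ-identityʳ f)) ,
  λ { h′ _ f≈h′ zero → coeff-≗ (≋-trans (mk≋ {f} f≈h′) (+ᴾ-identityʳ (h′ zero))) }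

decomposition-cons : ∀ n f h₀ x → InH (2 ℕ.+ n) h₀ → InΛw n x → f ≋ h₀ +ᴾ Q₂ x →
  UniqueHarmonicDecomposition n ⌊ n /2⌋ x → UniqueHarmonicDecomposition (2 ℕ.+ n) ⌊ 2 ℕ.+ n /2⌋ f
decomposition-cons n f h₀ x h₀H xΛw f≋h₀+Q₂x (hx , hxH , x≈hx , hx-unique) = h , hH , f≈h , unique
  where
  h : Fin (suc (suc ⌊ n /2⌋)) → Poly
  h zero = h₀
  h (suc i) = hx i
  hH : ∀ i → InH (2 ℕ.+ n ∸ 2 ℕ.* toℕ i) (h i)
  hH zero = h₀H
  hH (suc i) = subst (λ w → InH w (hx i)) (sym (∸-2*suc n (toℕ i))) (hxH i)
  f≈h : f ≈ decomp (suc (suc ⌊ n /2⌋)) h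
  f≈h = coeff-≗ (≋-trans f≋h₀+Q₂x (+ᴾ-cong (≋-refl {h₀}) (Q₂-cong (mk≋ {x} x≈hx))))
  unique : ∀ h′ → (∀ i → InH (2 ℕ.+ n ∸ 2 ℕ.* toℕ i) (h′ i)) → f ≈ decomp (suc (suc ⌊ n /2⌋)) h′ → ∀ i → h i ≈ h′ i
  unique h′ h′H f≈h′ = agree
    where
    tailH : ∀ i → InH (n ∸ 2 ℕ.* toℕ i) (h′ (suc i))
    tailH i = subst (λ w → InH w (h′ (suc i))) (∸-2*suc n (toℕ i)) (h′H (suc i))
    tail = decomp (suc ⌊ n /2⌋) (λ i → h′ (suc i))
    halves = harmonic-split-unique n h₀ (h′ zero) x tail h₀H (h′H zero) xΛw
      (decomp-InΛw n (λ i → h′ (suc i)) (λ i → proj₁ (tailH i))) (≋-trans (≋-sym f≋h₀+Q₂x) (mk≋ {f} f≈h′))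
    agree : ∀ i → h i ≈ h′ i
    agree zero = coeff-≗ (proj₁ halves)
    agree (suc i) = hx-unique (λ j → h′ (suc j)) tailH (coeff-≗ (proj₂ halves)) i

harmonic-decomposition : ∀ n f → InΛw n f → UniqueHarmonicDecomposition n ⌊ n /2⌋ f
harmonic-decomposition zero f fΛw = decomposition-below-2 0 f (s≤s z≤n) fΛw
harmonic-decomposition (suc zero) f fΛw = decomposition-below-2 1 f (s≤s (s≤s z≤n)) fΛw
harmonic-decomposition (suc (suc n)) f fΛw = extend (harmonic-split n f fΛw)
  where
  extend : HarmonicSplit n f → UniqueHarmonicDecomposition (2 ℕ.+ n) ⌊ 2 ℕ.+ n /2⌋ f
  extend (x , xΛw , h₀ , h₀H , f≋h₀+Q₂x) = decomposition-cons n f h₀ x h₀H xΛw f≋h₀+Q₂x (harmonic-decomposition n x xΛw)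

⌊n/2⌋≡n/2 : ∀ n → ⌊ n /2⌋ ≡ n / 2
⌊n/2⌋≡n/2 zero = refl
⌊n/2⌋≡n/2 (suc zero) = refl
⌊n/2⌋≡n/2 (suc (suc n)) = trans (cong suc (⌊n/2⌋≡n/2 n)) (sym (m/n≡1+[m∸n]/n {2 ℕ.+ n} {2} (s≤s (s≤s z≤n))))

theorem1p3 : (n : ℕ) (f : Poly) → InΛw n f →
    Σ (Fin (suc (n / 2)) → Poly) (λ h →
      (∀ i → InH (n ∸ 2 ℕ.* toℕ i) (h i)) ×
      f ≈ decomp (suc (n / 2)) h ×
      ((h′ : Fin (suc (n / 2)) → Poly) →
        (∀ i → InH (n ∸ 2 ℕ.* toℕ i) (h′ i)) →
        f ≈ decomp (suc (n / 2)) h′ →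
        ∀ i → h i ≈ h′ i))
theorem1p3 n f fΛw = subst (λ K → UniqueHarmonicDecomposition n K f) (⌊n/2⌋≡n/2 n) (harmonic-decomposition n f fΛw)
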